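{- Let $p$ be an odd prime with $p-1=q_1^{i_1}q_2^{i_2}\cdots q_m^{i_m}$, where $2=q_1<q_2<\dots<q_m$ are primes and all $i_j\ge1$. Suppose that $m\le 2k(m)+1$ and $q_m\ge131$. Then there exist positive integers $s$ and $t$ such that (i) $s$ and $t$ are coprime; (ii) a prime $q$ divides $p-1$ if and only if $q$ divides $st$; and (iii) $2\phi(t)/t>1+(4s-2)\sqrt{p}/(p-1)+(4s+2)/(p-1)$.
   Context: For an increasing sequence of primes $2=q_1<\dots<q_m$ define $d(n,m)=2\prod_{j=n}^{m}\left(1-\frac1{q_j}\right)$, and let $k(m)$ be the unique integer with $d(k(m)-1,m)\le1<d(k(m),m)$. Here $\phi$ is Euler's totient function. -}

module Defs where

open import Data.Nat as ℕ using (ℕ; zero; suc; _∸_; _+_)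
open import Data.Nat.GCD using (gcd)
open import Data.Nat.Properties using (_≟_)
open import Data.List using (List; map; upTo; filter; length; foldr)
open import Data.Integer using (ℤ) renaming (+_ to ℤ+)
open import Data.Rational using (ℚ; _/_; 0ℚ; 1ℚ; _*_; _-_; _<_)

φ : ℕ → ℕ
φ t = length (filter (λ a → gcd a t ≟ 1) (map suc (upTo t)))

range : ℕ → ℕ → List ℕ
range a b = map (λ i → a + i) (upTo (suc b ∸ a))

prodℚ : (ℕ → ℚ) → ℕ → ℕ → ℚ
prodℚ f a b = foldr _*_ 1ℚ (map f (range a b))

prodℕ : (ℕ → ℕ) → ℕ → ℕ → ℕ
prodℕ f a b = foldr ℕ._*_ 1 (map f (range a b))

-- 1/n as a rational (junk value 0 for n = 0; only used at primes)
inv : ℕ → ℚ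
inv zero    = 0ℚ
inv (suc n) = ℤ+ 1 / suc n

d : (ℕ → ℕ) → ℕ → ℕ → ℚ
d q n m = (ℤ+ 2 / 1) * prodℚ (λ j → 1ℚ - inv (q j)) n m

IsK : (ℕ → ℕ) → ℕ → ℕ → Set
IsK q m k = (1 ℕ.≤ k) Data.Product.× ((d q (k ∸ 1) m Data.Rational.≤ 1ℚ) Data.Product.× (1ℚ < d q k m))
  where import Data.Product

-- GtSqrt L c n : "L > c · √n"  for c ≥ 0, expressed without reals:
-- (since c ≥ 0) L > c√n  ⇔  0 < L  and  c² n < L²
GtSqrt : ℚ → ℚ → ℕ → Set
GtSqrt L c n = (0ℚ < L) Data.Product.× (c * c * (ℤ+ n / 1) < L * L)
  where import Data.Product

ℕtoℚ : ℕ → ℚ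
ℕtoℚ n = ℤ+ n / 1

-- Write N = p − 1. If k(m) ≥ 4 then, with a = k − 1, ∏_{j=a}^{m} (1 − 1/q_j) ≤ 1/2. The q_j are
-- odd and increasing from j = 2 on, so q_j ≥ 2j − 1, i.e. (1 − 1/q_j)² ≥ (4j − 5)/(4j − 1); this
-- telescopes to 1/4 ≥ (4a − 5)/(4m − 1), which with m ≤ 2a + 3 leaves only a = 3 and m ≤ 9, and
-- those cases fail numerically once q_5 ≥ 11 (9 is not prime) and q_m ≥ 131 are used. Hence
-- k ≤ 3 and m ≤ 7.
-- For 2 ≤ m ≤ 7 take s = q_1 (m ≤ 3) or s = q_1 q_2 (m ≥ 4) and t the product of the remaining
-- q_j. Then s t ≤ N, φ(t)/t = ∏ (1 − 1/q_j) is at least the same product over the lower bounds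
-- for the q_j, and after multiplying by t N and squaring, (iii) follows from two explicit
-- numerical inequalities between these products.

module Submission where

open import Defs
open import Data.Nat using (ℕ; suc; _+_; _*_; _∸_; _^_; _≤_; _<_)
open import Data.Nat.Primality using (Prime)
open import Data.Nat.Divisibility using (_∣_)
open import Data.Nat.Coprimality using (Coprime)
open import Data.Product using (_×_; Σ; ∃; ∃-syntax)
open import Data.Rational using (1ℚ; _-_)
open import Function.Bundles using (_⇔_)
open import Relation.Binary.PropositionalEquality using (_≡_)
open import Relation.Nullary using (¬_)

open import Data.Nat using (zero; pred; z≤n; s≤s; _≤ᵇ_; _<ᵇ_; NonZero; >-nonZero; nonTrivial⇒≢1; nonTrivial⇒n>1)
open import Data.Nat.Properties
open import Data.Nat.Tactic.RingSolver using (solve-∀)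
open import Data.Nat.Divisibility using (divides; ∣-refl; ∣-trans; ∣1⇒≡1; ∣m⇒∣m*n; ∣n⇒∣m*n; m∣m*n; n∣m*n; ∣m∣n⇒∣m+n; ∣m+n∣m⇒∣n; ∣⇒≤; _∣?_)
import Data.Nat.Coprimality as Coprime
open import Data.Nat.Primality using (euclidsLemma; prime⇒irreducible; prime⇒nonZero; prime⇒nonTrivial; prime?)
open import Data.Nat.GCD using (gcd)
open import Data.Integer as ℤ using () renaming (+_ to ℤ+)
import Data.Integer.Properties as ℤ
open import Data.Rational as ℚ using (ℚ; 0ℚ)
import Data.Rational.Properties as ℚ
open import Data.Rational.Unnormalised as ℚᵘ using (mkℚᵘ; *≡*; *≤*; *<*)
import Data.Rational.Unnormalised.Properties as ℚᵘ
open import Data.Rational.Solver using (module +-*-Solver)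
open import Data.Bool using (Bool; true; false; if_then_else_; T; _∧_)
open import Data.Bool.Properties using (T-∧)
open import Data.Unit using (tt)
open import Data.Empty using (⊥-elim)
open import Data.Sum using (_⊎_; inj₁; inj₂; [_,_]′)
open import Data.Product using (_,_; proj₁; proj₂)
open import Data.List using ([]; _∷_; _++_; [_]; map; filter; length; foldr; upTo; applyUpTo)
open import Data.List.Properties using (map-upTo; applyUpTo-∷ʳ; filter-++; length-++)
open import Function using (_∘_; _$_)
open import Function.Bundles using (mk⇔; Equivalence)
open import Relation.Binary.PropositionalEquality using (refl; sym; trans; cong; cong₂; subst; subst₂; module ≡-Reasoning)
open import Relation.Nullary using (Dec; yes; no; contradiction; ¬?; _×-dec_)
open import Relation.Nullary.Decidable using (from-no)
open import Relation.Unary using (Pred; Decidable)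
open import Relation.Unary.Properties using (_∩?_; ∁?)

ℕtoℚ-toℚᵘ : ∀ n → ℚ.toℚᵘ (ℕtoℚ n) ℚᵘ.≃ mkℚᵘ (ℤ+ n) 0
ℕtoℚ-toℚᵘ n = ℚ.toℚᵘ-fromℚᵘ (mkℚᵘ (ℤ+ n) 0)

ℕtoℚ-+ : ∀ a b → ℕtoℚ (a + b) ≡ ℕtoℚ a ℚ.+ ℕtoℚ b
ℕtoℚ-+ a b = ℚ.toℚᵘ-injective $
  ℚᵘ.≃-trans (ℕtoℚ-toℚᵘ (a + b)) $ ℚᵘ.≃-trans embedded $ ℚᵘ.≃-sym $
  ℚᵘ.≃-trans (ℚ.toℚᵘ-homo-+ (ℕtoℚ a) (ℕtoℚ b)) (ℚᵘ.+-cong (ℕtoℚ-toℚᵘ a) (ℕtoℚ-toℚᵘ b))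
  where
  embedded : mkℚᵘ (ℤ+ (a + b)) 0 ℚᵘ.≃ mkℚᵘ (ℤ+ a) 0 ℚᵘ.+ mkℚᵘ (ℤ+ b) 0
  embedded = *≡* (cong (ℤ._* ℤ+ 1) (trans (ℤ.pos-+ a b)
    (sym (cong₂ ℤ._+_ (ℤ.*-identityʳ (ℤ+ a)) (ℤ.*-identityʳ (ℤ+ b))))))

ℕtoℚ-* : ∀ a b → ℕtoℚ (a * b) ≡ ℕtoℚ a ℚ.* ℕtoℚ b
ℕtoℚ-* a b = ℚ.toℚᵘ-injective $
  ℚᵘ.≃-trans (ℕtoℚ-toℚᵘ (a * b)) $ ℚᵘ.≃-trans embedded $ ℚᵘ.≃-sym $
  ℚᵘ.≃-trans (ℚ.toℚᵘ-homo-* (ℕtoℚ a) (ℕtoℚ b)) (ℚᵘ.*-cong (ℕtoℚ-toℚᵘ a) (ℕtoℚ-toℚᵘ b))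
  where
  embedded : mkℚᵘ (ℤ+ (a * b)) 0 ℚᵘ.≃ mkℚᵘ (ℤ+ a) 0 ℚᵘ.* mkℚᵘ (ℤ+ b) 0
  embedded = *≡* (cong (ℤ._* ℤ+ 1) (ℤ.pos-* a b))

ℕtoℚ-mono-≤ : ∀ {a b} → a ≤ b → ℕtoℚ a ℚ.≤ ℕtoℚ b
ℕtoℚ-mono-≤ {a} {b} a≤b = ℚ.toℚᵘ-cancel-≤ $
  ℚᵘ.≤-respʳ-≃ (ℚᵘ.≃-sym (ℕtoℚ-toℚᵘ b)) $ ℚᵘ.≤-respˡ-≃ (ℚᵘ.≃-sym (ℕtoℚ-toℚᵘ a)) $
  *≤* (subst₂ ℤ._≤_ (sym (ℤ.*-identityʳ (ℤ+ a))) (sym (ℤ.*-identityʳ (ℤ+ b))) (ℤ.+≤+ a≤b))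

ℕtoℚ-mono-< : ∀ {a b} → a < b → ℕtoℚ a ℚ.< ℕtoℚ b
ℕtoℚ-mono-< {a} {b} a<b = ℚ.toℚᵘ-cancel-< $
  ℚᵘ.<-respʳ-≃ (ℚᵘ.≃-sym (ℕtoℚ-toℚᵘ b)) $ ℚᵘ.<-respˡ-≃ (ℚᵘ.≃-sym (ℕtoℚ-toℚᵘ a)) $
  *<* (subst₂ ℤ._<_ (sym (ℤ.*-identityʳ (ℤ+ a))) (sym (ℤ.*-identityʳ (ℤ+ b))) (ℤ.+<+ a<b))

ℕtoℚ-cancel-≤ : ∀ {a b} → ℕtoℚ a ℚ.≤ ℕtoℚ b → a ≤ b
ℕtoℚ-cancel-≤ {a} {b} le
  with ℚᵘ.≤-respʳ-≃ (ℕtoℚ-toℚᵘ b) (ℚᵘ.≤-respˡ-≃ (ℕtoℚ-toℚᵘ a) (ℚ.toℚᵘ-mono-≤ le))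
... | *≤* h = ℤ.drop‿+≤+ (subst₂ ℤ._≤_ (ℤ.*-identityʳ (ℤ+ a)) (ℤ.*-identityʳ (ℤ+ b)) h)

ℕtoℚ-nonNeg : ∀ n → 0ℚ ℚ.≤ ℕtoℚ n
ℕtoℚ-nonNeg n = ℕtoℚ-mono-≤ {0} {n} z≤n

inv-inverseˡ : ∀ {n} → 1 ≤ n → inv n ℚ.* ℕtoℚ n ≡ 1ℚ
inv-inverseˡ {suc n} _ = ℚ.toℚᵘ-injective $
  ℚᵘ.≃-trans (ℚ.toℚᵘ-homo-* (inv (suc n)) (ℕtoℚ (suc n))) $
  ℚᵘ.≃-trans (ℚᵘ.*-cong (ℚ.toℚᵘ-fromℚᵘ (mkℚᵘ (ℤ+ 1) n)) (ℕtoℚ-toℚᵘ (suc n))) $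
  *≡* (trans (ℤ.*-identityʳ _) (trans (ℤ.*-identityˡ _)
    (sym (trans (ℤ.*-identityˡ _) (cong (λ x → ℤ+ (suc x)) (*-identityʳ n))))))

-- A sufficient condition for (iii)

[4s∸2]²[N+1]≤16s²N : ∀ s N → 1 ≤ s → s ≤ N → (4 * s ∸ 2) * (4 * s ∸ 2) * suc N ≤ 16 * s * s * N
[4s∸2]²[N+1]≤16s²N (suc s) N _ s≤N with m≤n⇒∃[o]m+o≡n s≤N
... | w , refl = begin
  (4 * suc s ∸ 2) * (4 * suc s ∸ 2) * suc (suc s + w) ≡⟨ cong (λ c → c * c * suc (suc s + w)) (4[1+s]∸2 s) ⟩
  (2 + 4 * s) * (2 + 4 * s) * suc (suc s + w)        ≤⟨ m≤m+n _ _ ⟩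
  (2 + 4 * s) * (2 + 4 * s) * suc (suc s + w) + ((12 + 16 * s) * w + 8 + 12 * s) ≡⟨ expand s w ⟩
  16 * suc s * suc s * (suc s + w)                   ∎
  where
  open ≤-Reasoning
  4[1+s]∸2 : ∀ s → 4 * suc s ∸ 2 ≡ 2 + 4 * s
  4[1+s]∸2 s = cong (_∸ 2) (*-distribˡ-+ 4 1 s)
  expand : ∀ s w → (2 + 4 * s) * (2 + 4 * s) * suc (suc s + w) + ((12 + 16 * s) * w + 8 + 12 * s)
                 ≡ 16 * suc s * suc s * (suc s + w)
  expand = solve-∀

-- Y = E N − (4s + 2) t is t N times the left-hand side of (iii). The slack 10 (4s + 2) ≤ E s gives
-- Y ≥ 9 E N / 10, and then 81 E² > 1600 s t and s t ≤ N beat (4s − 2)² t² (N + 1) ≤ 16 s² t² N.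
sqrt-criterionℕ : ∀ s t N E → 1 ≤ s → 1 ≤ t → s * t ≤ N →
                  10 * (4 * s + 2) ≤ E * s → 1600 * s * t < 81 * (E * E) →
                  ∃[ Y ] (Y + (4 * s + 2) * t ≡ E * N × 0 < Y ×
                          (4 * s ∸ 2) * t * ((4 * s ∸ 2) * t) * suc N < Y * Y)
sqrt-criterionℕ s t N E s≥1 t≥1 st≤N slack bound = Y , Y+At≡EN , Y>0 , squares
  where
  open ≤-Reasoning
  A = 4 * s + 2
  C = 4 * s ∸ 2
  10At≤EN : 10 * (A * t) ≤ E * N
  10At≤EN = begin
    10 * (A * t) ≡⟨ sym (*-assoc 10 A t) ⟩
    10 * A * t   ≤⟨ *-monoˡ-≤ t slack ⟩
    E * s * t    ≡⟨ *-assoc E s t ⟩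
    E * (s * t)  ≤⟨ *-monoʳ-≤ E st≤N ⟩
    E * N        ∎
  Y = E * N ∸ A * t
  Y+At≡EN : Y + A * t ≡ E * N
  Y+At≡EN = m∸n+n≡m (≤-trans (m≤n*m (A * t) 10) 10At≤EN)
  9EN≤10Y : 9 * (E * N) ≤ 10 * Y
  9EN≤10Y = +-cancelʳ-≤ (E * N) _ _ $ begin
    9 * (E * N) + E * N       ≡⟨ +-comm (9 * (E * N)) (E * N) ⟩
    10 * (E * N)              ≡⟨ cong (10 *_) (sym Y+At≡EN) ⟩
    10 * (Y + A * t)          ≡⟨ *-distribˡ-+ 10 Y (A * t) ⟩
    10 * Y + 10 * (A * t)     ≤⟨ +-monoʳ-≤ (10 * Y) 10At≤EN ⟩
    10 * Y + E * N            ∎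
  N>0 : 0 < N
  N>0 = ≤-trans (*-mono-≤ s≥1 t≥1) st≤N
  E>0 : 0 < E
  E>0 = n≢0⇒n>0 λ { refl → contradiction bound λ () }
  Y>0 : 0 < Y
  Y>0 = *-cancelˡ-< 10 0 Y (<-≤-trans (*-monoʳ-< 9 (*-mono-< {0} {E} {0} {N} E>0 N>0)) 9EN≤10Y)
  squares : C * t * (C * t) * suc N < Y * Y
  squares = *-cancelˡ-< 100 _ _ $ begin-strict
    100 * (C * t * (C * t) * suc N)  ≡⟨ r₁ C t N ⟩
    100 * (t * t) * (C * C * suc N)  ≤⟨ *-monoʳ-≤ (100 * (t * t)) ([4s∸2]²[N+1]≤16s²N s N s≥1 s≤N) ⟩
    100 * (t * t) * (16 * s * s * N) ≡⟨ r₂ s t N ⟩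
    1600 * s * t * (s * t) * N       ≤⟨ *-monoˡ-≤ N (*-monoʳ-≤ (1600 * s * t) st≤N) ⟩
    1600 * s * t * N * N             <⟨ *-monoˡ-< N {{>-nonZero N>0}} (*-monoˡ-< N {{>-nonZero N>0}} bound) ⟩
    81 * (E * E) * N * N             ≡⟨ r₃ E N ⟩
    (9 * (E * N)) * (9 * (E * N))    ≤⟨ *-mono-≤ 9EN≤10Y 9EN≤10Y ⟩
    (10 * Y) * (10 * Y)              ≡⟨ r₄ Y ⟩
    100 * (Y * Y)                    ∎
    where
    s≤N : s ≤ N
    s≤N = ≤-trans (m≤m*n s t) st≤N
      where instance _ = >-nonZero t≥1
    r₁ : ∀ C t N → 100 * (C * t * (C * t) * suc N) ≡ 100 * (t * t) * (C * C * suc N)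
    r₁ = solve-∀
    r₂ : ∀ s t N → 100 * (t * t) * (16 * s * s * N) ≡ 1600 * s * t * (s * t) * N
    r₂ = solve-∀
    r₃ : ∀ E N → 81 * (E * E) * N * N ≡ (9 * (E * N)) * (9 * (E * N))
    r₃ = solve-∀
    r₄ : ∀ Y → (10 * Y) * (10 * Y) ≡ 100 * (Y * Y)
    r₄ = solve-∀

GtSqrt-scale : ∀ L c K n → 0ℚ ℚ.≤ K → 0ℚ ℚ.< L ℚ.* K →
               (c ℚ.* K) ℚ.* (c ℚ.* K) ℚ.* ℕtoℚ n ℚ.< (L ℚ.* K) ℚ.* (L ℚ.* K) → GtSqrt L c n
GtSqrt-scale L c K n K≥0 LK>0 scaled =
  ℚ.*-cancelʳ-<-nonNeg K (subst (ℚ._< L ℚ.* K) (sym (ℚ.*-zeroˡ K)) LK>0) ,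
  ℚ.*-cancelʳ-<-nonNeg (K ℚ.* K) {{ℚ.nonNeg*nonNeg⇒nonNeg K K}}
    (subst₂ ℚ._<_ (regroup c) (solve 2 (λ x k → (x :* k) :* (x :* k) := x :* x :* (k :* k)) refl L K) scaled)
  where
  open +-*-Solver
  instance
    K-nonNeg : ℚ.NonNegative K
    K-nonNeg = ℚ.nonNegative K≥0
  regroup : ∀ x → (x ℚ.* K) ℚ.* (x ℚ.* K) ℚ.* ℕtoℚ n ≡ x ℚ.* x ℚ.* ℕtoℚ n ℚ.* (K ℚ.* K)
  regroup x = solve 3 (λ x k n → (x :* k) :* (x :* k) :* n := x :* x :* n :* (k :* k)) refl x K (ℕtoℚ n)

lhs-scaling-identity : ∀ x i a j T M y → i ℚ.* T ≡ 1ℚ → j ℚ.* M ≡ 1ℚ → x ℚ.* M ≡ T ℚ.* M ℚ.+ (y ℚ.+ a ℚ.* T) →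
                       (x ℚ.* i - 1ℚ - a ℚ.* j) ℚ.* (T ℚ.* M) ≡ y
lhs-scaling-identity x i a j T M y iT≡1 jM≡1 xM≡ = begin
  (x ℚ.* i - 1ℚ - a ℚ.* j) ℚ.* (T ℚ.* M)
    ≡⟨ solve 6 (λ x i a j T M → (x :* i :- con 1ℚ :- a :* j) :* (T :* M) := x :* M :* (i :* T) :- T :* M :- a :* T :* (j :* M))
             refl x i a j T M ⟩
  x ℚ.* M ℚ.* (i ℚ.* T) - T ℚ.* M - a ℚ.* T ℚ.* (j ℚ.* M)
    ≡⟨ cong₂ (λ u v → x ℚ.* M ℚ.* u - T ℚ.* M - a ℚ.* T ℚ.* v) iT≡1 jM≡1 ⟩
  x ℚ.* M ℚ.* 1ℚ - T ℚ.* M - a ℚ.* T ℚ.* 1ℚ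
    ≡⟨ cong (λ u → u ℚ.* 1ℚ - T ℚ.* M - a ℚ.* T ℚ.* 1ℚ) xM≡ ⟩
  (T ℚ.* M ℚ.+ (y ℚ.+ a ℚ.* T)) ℚ.* 1ℚ - T ℚ.* M - a ℚ.* T ℚ.* 1ℚ
    ≡⟨ solve 4 (λ T M y a → (T :* M :+ (y :+ a :* T)) :* con 1ℚ :- T :* M :- a :* T :* con 1ℚ := y) refl T M y a ⟩
  y ∎
  where open ≡-Reasoning; open +-*-Solver

rhs-scaling-identity : ∀ x j T M → j ℚ.* M ≡ 1ℚ → x ℚ.* j ℚ.* (T ℚ.* M) ≡ x ℚ.* T
rhs-scaling-identity x j T M jM≡1 = begin
  x ℚ.* j ℚ.* (T ℚ.* M)    ≡⟨ solve 4 (λ x j T M → x :* j :* (T :* M) := x :* T :* (j :* M)) refl x j T M ⟩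
  x ℚ.* T ℚ.* (j ℚ.* M)    ≡⟨ cong (x ℚ.* T ℚ.*_) jM≡1 ⟩
  x ℚ.* T ℚ.* 1ℚ           ≡⟨ ℚ.*-identityʳ (x ℚ.* T) ⟩
  x ℚ.* T                  ∎
  where open ≡-Reasoning; open +-*-Solver

lhs-scaled : ∀ t N Φ E A Y → 1 ≤ t → 1 ≤ N → t + E ≡ 2 * Φ → Y + A * t ≡ E * N →
             (ℕtoℚ (2 * Φ) ℚ.* inv t - 1ℚ - ℕtoℚ A ℚ.* inv N) ℚ.* (ℕtoℚ t ℚ.* ℕtoℚ N) ≡ ℕtoℚ Y
lhs-scaled t N Φ E A Y t≥1 N≥1 t+E≡2Φ Y+At≡EN =
  lhs-scaling-identity (ℕtoℚ (2 * Φ)) (inv t) (ℕtoℚ A) (inv N) (ℕtoℚ t) (ℕtoℚ N) (ℕtoℚ Y)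
    (inv-inverseˡ t≥1) (inv-inverseˡ N≥1) $ begin
      ℕtoℚ (2 * Φ) ℚ.* ℕtoℚ N                ≡⟨ sym (ℕtoℚ-* (2 * Φ) N) ⟩
      ℕtoℚ (2 * Φ * N)                       ≡⟨ cong ℕtoℚ 2ΦN ⟩
      ℕtoℚ (t * N + (Y + A * t))             ≡⟨ ℕtoℚ-+ (t * N) (Y + A * t) ⟩
      ℕtoℚ (t * N) ℚ.+ ℕtoℚ (Y + A * t)      ≡⟨ cong₂ ℚ._+_ (ℕtoℚ-* t N) (trans (ℕtoℚ-+ Y (A * t)) (cong (ℕtoℚ Y ℚ.+_) (ℕtoℚ-* A t))) ⟩
      ℕtoℚ t ℚ.* ℕtoℚ N ℚ.+ (ℕtoℚ Y ℚ.+ ℕtoℚ A ℚ.* ℕtoℚ t) ∎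
  where
  open ≡-Reasoning
  2ΦN : 2 * Φ * N ≡ t * N + (Y + A * t)
  2ΦN = begin
    2 * Φ * N           ≡⟨ cong (_* N) (sym t+E≡2Φ) ⟩
    (t + E) * N         ≡⟨ *-distribʳ-+ N t E ⟩
    t * N + E * N       ≡⟨ cong ((t * N) +_) (sym Y+At≡EN) ⟩
    t * N + (Y + A * t) ∎

rhs-scaled : ∀ t N C → 1 ≤ N → (ℕtoℚ C ℚ.* inv N) ℚ.* (ℕtoℚ t ℚ.* ℕtoℚ N) ≡ ℕtoℚ (C * t)
rhs-scaled t N C N≥1 = trans (rhs-scaling-identity (ℕtoℚ C) (inv N) (ℕtoℚ t) (ℕtoℚ N) (inv-inverseˡ N≥1)) (sym (ℕtoℚ-* C t))

gtSqrt-scaled : ∀ s t N Φ E Y → t + E ≡ 2 * Φ → 1 ≤ t → 1 ≤ N →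
                Y + (4 * s + 2) * t ≡ E * N → 0 < Y → (4 * s ∸ 2) * t * ((4 * s ∸ 2) * t) * suc N < Y * Y →
                GtSqrt (ℕtoℚ (2 * Φ) ℚ.* inv t - 1ℚ - ℕtoℚ (4 * s + 2) ℚ.* inv N)
                       (ℕtoℚ (4 * s ∸ 2) ℚ.* inv N) (suc N)
gtSqrt-scaled s t N Φ E Y t+E≡2Φ t≥1 N≥1 Y+At≡EN Y>0 squares =
  GtSqrt-scale L c K (suc N) (subst (0ℚ ℚ.≤_) (ℕtoℚ-* t N) (ℕtoℚ-nonNeg (t * N)))
    (subst (0ℚ ℚ.<_) (sym L*K≡Y) (ℕtoℚ-mono-< Y>0))
    (subst₂ ℚ._<_ (sym cK²[N+1]) (sym LK²) (ℕtoℚ-mono-< squares))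
  where
  open ≡-Reasoning
  C = 4 * s ∸ 2
  L = ℕtoℚ (2 * Φ) ℚ.* inv t - 1ℚ - ℕtoℚ (4 * s + 2) ℚ.* inv N
  c = ℕtoℚ C ℚ.* inv N
  K = ℕtoℚ t ℚ.* ℕtoℚ N
  L*K≡Y : L ℚ.* K ≡ ℕtoℚ Y
  L*K≡Y = lhs-scaled t N Φ E (4 * s + 2) Y t≥1 N≥1 t+E≡2Φ Y+At≡EN
  LK² : L ℚ.* K ℚ.* (L ℚ.* K) ≡ ℕtoℚ (Y * Y)
  LK² = trans (cong (λ u → u ℚ.* u) L*K≡Y) (sym (ℕtoℚ-* Y Y))
  cK²[N+1] : c ℚ.* K ℚ.* (c ℚ.* K) ℚ.* ℕtoℚ (suc N) ≡ ℕtoℚ (C * t * (C * t) * suc N)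
  cK²[N+1] = begin
    c ℚ.* K ℚ.* (c ℚ.* K) ℚ.* ℕtoℚ (suc N)           ≡⟨ cong (λ u → u ℚ.* u ℚ.* ℕtoℚ (suc N)) (rhs-scaled t N C N≥1) ⟩
    ℕtoℚ (C * t) ℚ.* ℕtoℚ (C * t) ℚ.* ℕtoℚ (suc N)   ≡⟨ cong (ℚ._* ℕtoℚ (suc N)) (sym (ℕtoℚ-* (C * t) (C * t))) ⟩
    ℕtoℚ (C * t * (C * t)) ℚ.* ℕtoℚ (suc N)           ≡⟨ sym (ℕtoℚ-* (C * t * (C * t)) (suc N)) ⟩
    ℕtoℚ (C * t * (C * t) * suc N)                    ∎

gtSqrt-criterion : ∀ s t N Φ E → t + E ≡ 2 * Φ → 1 ≤ s → 1 ≤ t → s * t ≤ N →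
                   10 * (4 * s + 2) ≤ E * s → 1600 * s * t < 81 * (E * E) →
                   GtSqrt (ℕtoℚ (2 * Φ) ℚ.* inv t - 1ℚ - ℕtoℚ (4 * s + 2) ℚ.* inv N)
                          (ℕtoℚ (4 * s ∸ 2) ℚ.* inv N) (suc N)
gtSqrt-criterion s t N Φ E t+E≡2Φ s≥1 t≥1 st≤N slack bound =
  let Y , Y+At≡EN , Y>0 , squares = sqrt-criterionℕ s t N E s≥1 t≥1 st≤N slack bound
  in  gtSqrt-scaled s t N Φ E Y t+E≡2Φ t≥1 (≤-trans (*-mono-≤ s≥1 t≥1) st≤N) Y+At≡EN Y>0 squares

-- 2Φ/t − 1 ≥ 2B′/B − 1 = G/B, where E = 2Φ − t.
excess-lower-bound : ∀ t Φ B B′ G → 1 ≤ B → G + B ≡ 2 * B′ → B′ * t ≤ Φ * B →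
                     t + (2 * Φ ∸ t) ≡ 2 * Φ × G * t ≤ (2 * Φ ∸ t) * B
excess-lower-bound t Φ B B′ G B≥1 G+B≡2B′ B′t≤ΦB = t+E≡2Φ , Gt≤EB
  where
  instance
    B≢0 : NonZero B
    B≢0 = >-nonZero B≥1
  2B′t≤2ΦB : (G + B) * t ≤ 2 * Φ * B
  2B′t≤2ΦB = begin
    (G + B) * t   ≡⟨ cong (_* t) G+B≡2B′ ⟩
    2 * B′ * t    ≡⟨ *-assoc 2 B′ t ⟩
    2 * (B′ * t)  ≤⟨ *-monoʳ-≤ 2 B′t≤ΦB ⟩
    2 * (Φ * B)   ≡⟨ sym (*-assoc 2 Φ B) ⟩
    2 * Φ * B     ∎
    where open ≤-Reasoning
  t≤2Φ : t ≤ 2 * Φ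
  t≤2Φ = *-cancelʳ-≤ t (2 * Φ) B $ begin
    t * B         ≡⟨ *-comm t B ⟩
    B * t         ≤⟨ *-monoˡ-≤ t (m≤n+m B G) ⟩
    (G + B) * t   ≤⟨ 2B′t≤2ΦB ⟩
    2 * Φ * B     ∎
    where open ≤-Reasoning
  E = 2 * Φ ∸ t
  t+E≡2Φ : t + E ≡ 2 * Φ
  t+E≡2Φ = m+[n∸m]≡n t≤2Φ
  Gt≤EB : G * t ≤ E * B
  Gt≤EB = +-cancelˡ-≤ (t * B) _ _ $ begin
    t * B + G * t  ≡⟨ cong₂ _+_ (*-comm t B) refl ⟩
    B * t + G * t  ≡⟨ sym (*-distribʳ-+ t B G) ⟩
    (B + G) * t    ≡⟨ cong (_* t) (+-comm B G) ⟩
    (G + B) * t    ≤⟨ 2B′t≤2ΦB ⟩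
    2 * Φ * B      ≡⟨ cong (_* B) (sym t+E≡2Φ) ⟩
    (t + E) * B    ≡⟨ *-distribʳ-+ B t E ⟩
    t * B + E * B  ∎
    where open ≤-Reasoning

criterion-from-bounds : ∀ s t E B G R → 1 ≤ s → 1 ≤ B → B ≤ t → G * t ≤ E * B → 60 ≤ G →
                        s * R ≤ 2 * t → 3200 * (B * B) < 81 * (G * G) * R →
                        10 * (4 * s + 2) ≤ E * s × 1600 * s * t < 81 * (E * E)
criterion-from-bounds s t E B G R s≥1 B≥1 B≤t Gt≤EB 60≤G sR≤2t margin = slack , bound
  where
  instance
    B≢0 : NonZero B
    B≢0 = >-nonZero B≥1
  G≤E : G ≤ E
  G≤E = *-cancelʳ-≤ G E B (≤-trans (*-monoʳ-≤ G B≤t) Gt≤EB)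
  slack : 10 * (4 * s + 2) ≤ E * s
  slack = begin
    10 * (4 * s + 2)  ≡⟨ e₁ s ⟩
    40 * s + 20       ≤⟨ +-monoʳ-≤ (40 * s) (*-monoʳ-≤ 20 s≥1) ⟩
    40 * s + 20 * s   ≡⟨ e₂ s ⟩
    60 * s            ≤⟨ *-monoˡ-≤ s (≤-trans 60≤G G≤E) ⟩
    E * s             ∎
    where
    open ≤-Reasoning
    e₁ : ∀ s → 10 * (4 * s + 2) ≡ 40 * s + 20
    e₁ = solve-∀
    e₂ : ∀ s → 40 * s + 20 * s ≡ 60 * s
    e₂ = solve-∀
  halved : 1600 * s * (B * B) < 81 * (G * G) * t
  halved = *-cancelˡ-< 2 _ _ $ begin-strict
    2 * (1600 * s * (B * B))   ≡⟨ e₁ s B ⟩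
    s * (3200 * (B * B))       <⟨ *-monoʳ-< s {{>-nonZero s≥1}} margin ⟩
    s * (81 * (G * G) * R)     ≡⟨ e₂ s G R ⟩
    81 * (G * G) * (s * R)     ≤⟨ *-monoʳ-≤ (81 * (G * G)) sR≤2t ⟩
    81 * (G * G) * (2 * t)     ≡⟨ e₃ G t ⟩
    2 * (81 * (G * G) * t)     ∎
    where
    open ≤-Reasoning
    e₁ : ∀ s B → 2 * (1600 * s * (B * B)) ≡ s * (3200 * (B * B))
    e₁ = solve-∀
    e₂ : ∀ s G R → s * (81 * (G * G) * R) ≡ 81 * (G * G) * (s * R)
    e₂ = solve-∀
    e₃ : ∀ G t → 81 * (G * G) * (2 * t) ≡ 2 * (81 * (G * G) * t)
    e₃ = solve-∀
  bound : 1600 * s * t < 81 * (E * E)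
  bound = *-cancelʳ-< (B * B) _ _ $ begin-strict
    1600 * s * t * (B * B)       ≡⟨ e₁ s t B ⟩
    t * (1600 * s * (B * B))     <⟨ *-monoʳ-< t {{>-nonZero (≤-trans B≥1 B≤t)}} halved ⟩
    t * (81 * (G * G) * t)       ≡⟨ e₂ t G ⟩
    81 * ((G * t) * (G * t))     ≤⟨ *-monoʳ-≤ 81 (*-mono-≤ Gt≤EB Gt≤EB) ⟩
    81 * ((E * B) * (E * B))     ≡⟨ e₃ E B ⟩
    81 * (E * E) * (B * B)       ∎
    where
    open ≤-Reasoning
    e₁ : ∀ s t B → 1600 * s * t * (B * B) ≡ t * (1600 * s * (B * B))
    e₁ = solve-∀
    e₂ : ∀ t G → t * (81 * (G * G) * t) ≡ 81 * ((G * t) * (G * t))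
    e₂ = solve-∀
    e₃ : ∀ E B → 81 * ((E * B) * (E * B)) ≡ 81 * (E * E) * (B * B)
    e₃ = solve-∀

-- Products over intervals

∏ : (ℕ → ℕ) → ℕ → ℕ → ℕ
∏ f a zero    = 1
∏ f a (suc n) = f a * ∏ f (suc a) n

AllIn : ℕ → ℕ → (ℕ → Set) → Set
AllIn a n P = ∀ {j} → a ≤ j → j < a + n → P j

AllIn-head : ∀ {a n} (P : ℕ → Set) → AllIn a (suc n) P → P a
AllIn-head {a} {n} _ h = h ≤-refl (m<m+n a (s≤s z≤n))

AllIn-tail : ∀ {a n} (P : ℕ → Set) → AllIn a (suc n) P → AllIn (suc a) n P
AllIn-tail {a} {n} _ h {j} a<j j<a+n = h (<⇒≤ a<j) (subst (j <_) (sym (+-suc a n)) j<a+n)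

interval-bound : ∀ {a b j} → a ≤ j → j < a + (suc b ∸ a) → j ≤ b
interval-bound {a} {b} {j} a≤j j<a+n with a ≤? suc b
... | yes a≤1+b = ≤-pred (subst (j <_) (m+[n∸m]≡n a≤1+b) j<a+n)
... | no  a≰1+b = contradiction (subst (j <_) (trans (cong (a +_) (m≤n⇒m∸n≡0 (<⇒≤ (≰⇒> a≰1+b)))) (+-identityʳ a)) j<a+n) (≤⇒≯ a≤j)

prodℕ≡∏ : ∀ f a b → prodℕ f a b ≡ ∏ f a (suc b ∸ a)
prodℕ≡∏ f a b = trans (cong (foldr _*_ 1 ∘ map f) (map-upTo (a +_) (suc b ∸ a))) (fold≡∏ (suc b ∸ a) (a +_) a (λ _ → refl))
  where
  fold≡∏ : ∀ n g a → (∀ i → g i ≡ a + i) → foldr _*_ 1 (map f (applyUpTo g n)) ≡ ∏ f a n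
  fold≡∏ zero    g a g≗ = refl
  fold≡∏ (suc n) g a g≗ = cong₂ _*_ (cong f (trans (g≗ 0) (+-identityʳ a)))
                                    (fold≡∏ n (g ∘ suc) (suc a) (λ i → trans (g≗ (suc i)) (+-suc a i)))

∏-mono-≤ : ∀ f g a n → AllIn a n (λ j → f j ≤ g j) → ∏ f a n ≤ ∏ g a n
∏-mono-≤ f g a zero    f≤g = ≤-refl
∏-mono-≤ f g a (suc n) f≤g = *-mono-≤ (AllIn-head _ f≤g) (∏-mono-≤ f g (suc a) n (AllIn-tail _ f≤g))

∏-positive : ∀ f a n → AllIn a n (λ j → 1 ≤ f j) → 1 ≤ ∏ f a n
∏-positive f a zero    f≥1 = ≤-refl
∏-positive f a (suc n) f≥1 = *-mono-≤ (AllIn-head _ f≥1) (∏-positive f (suc a) n (AllIn-tail _ f≥1))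

∏-+ : ∀ f a n₁ n₂ → ∏ f a (n₁ + n₂) ≡ ∏ f a n₁ * ∏ f (a + n₁) n₂
∏-+ f a zero     n₂ = trans (cong (λ b → ∏ f b n₂) (sym (+-identityʳ a))) (sym (+-identityʳ _))
∏-+ f a (suc n₁) n₂ = begin
  f a * ∏ f (suc a) (n₁ + n₂)               ≡⟨ cong (f a *_) (∏-+ f (suc a) n₁ n₂) ⟩
  f a * (∏ f (suc a) n₁ * ∏ f (suc a + n₁) n₂) ≡⟨ cong (λ b → f a * (∏ f (suc a) n₁ * ∏ f b n₂)) (sym (+-suc a n₁)) ⟩
  f a * (∏ f (suc a) n₁ * ∏ f (a + suc n₁) n₂) ≡⟨ sym (*-assoc (f a) _ _) ⟩
  f a * ∏ f (suc a) n₁ * ∏ f (a + suc n₁) n₂ ∎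
  where open ≡-Reasoning

coprime-* : ∀ {a b c} → Coprime a b → Coprime a c → Coprime a (b * c)
coprime-* a⊥b a⊥c {d} (d∣a , d∣bc) = a⊥c (d∣a , Coprime.coprime-divisor d⊥b d∣bc)
  where
  d⊥b : Coprime d _
  d⊥b (e∣d , e∣b) = a⊥b (∣-trans e∣d d∣a , e∣b)

∏-coprime : ∀ x f a n → AllIn a n (λ j → Coprime x (f j)) → Coprime x (∏ f a n)
∏-coprime x f a zero    x⊥f (_ , d∣1) = ∣1⇒≡1 d∣1
∏-coprime x f a (suc n) x⊥f = coprime-* (AllIn-head _ x⊥f) (∏-coprime x f (suc a) n (AllIn-tail _ x⊥f))

∏-prime-∣ : ∀ {r} f g a n → Prime r → AllIn a n (λ j → r ∣ f j → r ∣ g j) → r ∣ ∏ f a n → r ∣ ∏ g a n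
∏-prime-∣ f g a zero    r-prime f⇒g r∣∏ = r∣∏
∏-prime-∣ f g a (suc n) r-prime f⇒g r∣∏ with euclidsLemma (f a) (∏ f (suc a) n) r-prime r∣∏
... | inj₁ r∣fa = ∣m⇒∣m*n _ (AllIn-head _ f⇒g r∣fa)
... | inj₂ r∣∏′ = ∣n⇒∣m*n (g a) (∏-prime-∣ f g (suc a) n r-prime (AllIn-tail _ f⇒g) r∣∏′)

[1-1/x]-mono : ∀ {b x} → b ≤ x → pred b * x ≤ pred x * b
[1-1/x]-mono {zero}  {x}     b≤x       = z≤n
[1-1/x]-mono {suc b} {suc x} (s≤s b≤x) = begin
  b * suc x  ≡⟨ *-suc b x ⟩
  b + b * x  ≤⟨ +-monoˡ-≤ (b * x) b≤x ⟩
  x + b * x  ≡⟨ cong (x +_) (*-comm b x) ⟩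
  x + x * b  ≡⟨ sym (*-suc x b) ⟩
  x * suc b  ∎
  where open ≤-Reasoning

∏[1-1/x]-mono : ∀ b q a n → AllIn a n (λ j → b j ≤ q j) →
                ∏ (pred ∘ b) a n * ∏ q a n ≤ ∏ (pred ∘ q) a n * ∏ b a n
∏[1-1/x]-mono b q a zero    b≤q = ≤-refl
∏[1-1/x]-mono b q a (suc n) b≤q = begin
  pred (b a) * ∏ (pred ∘ b) (suc a) n * (q a * ∏ q (suc a) n)        ≡⟨ interchange (pred (b a)) _ (q a) _ ⟩
  pred (b a) * q a * (∏ (pred ∘ b) (suc a) n * ∏ q (suc a) n)        ≤⟨ *-mono-≤ ([1-1/x]-mono (AllIn-head _ b≤q))
                                                                                   (∏[1-1/x]-mono b q (suc a) n (AllIn-tail _ b≤q)) ⟩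
  pred (q a) * b a * (∏ (pred ∘ q) (suc a) n * ∏ b (suc a) n)        ≡⟨ interchange (pred (q a)) (b a) _ _ ⟩
  pred (q a) * ∏ (pred ∘ q) (suc a) n * (b a * ∏ b (suc a) n)        ∎
  where
  open ≤-Reasoning
  interchange : ∀ x y z w → x * y * (z * w) ≡ x * z * (y * w)
  interchange = solve-∀

∏[1-1/x]≤½-mono : ∀ b q a n → AllIn a n (λ j → b j ≤ q j) → 1 ≤ ∏ q a n →
                  2 * ∏ (pred ∘ q) a n ≤ ∏ q a n → 2 * ∏ (pred ∘ b) a n ≤ ∏ b a n
∏[1-1/x]≤½-mono b q a n b≤q ∏q≥1 half = *-cancelʳ-≤ _ _ (∏ q a n) {{>-nonZero ∏q≥1}} $ begin
  2 * B′ * Q  ≡⟨ *-assoc 2 B′ Q ⟩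
  2 * (B′ * Q) ≤⟨ *-monoʳ-≤ 2 (∏[1-1/x]-mono b q a n b≤q) ⟩
  2 * (Q′ * B) ≡⟨ sym (*-assoc 2 Q′ B) ⟩
  2 * Q′ * B   ≤⟨ *-monoˡ-≤ B half ⟩
  Q * B        ≡⟨ *-comm Q B ⟩
  B * Q        ∎
  where
  open ≤-Reasoning
  B = ∏ b a n
  B′ = ∏ (pred ∘ b) a n
  Q = ∏ q a n
  Q′ = ∏ (pred ∘ q) a n

[1-inv]*ℕtoℚ : ∀ x → (1ℚ - inv x) ℚ.* ℕtoℚ x ≡ ℕtoℚ (pred x)
[1-inv]*ℕtoℚ zero    = refl
[1-inv]*ℕtoℚ (suc n) = begin
  (1ℚ - inv (suc n)) ℚ.* ℕtoℚ (suc n)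
    ≡⟨ solve 2 (λ i x → (con 1ℚ :- i) :* x := x :- i :* x) refl (inv (suc n)) (ℕtoℚ (suc n)) ⟩
  ℕtoℚ (suc n) - inv (suc n) ℚ.* ℕtoℚ (suc n)
    ≡⟨ cong₂ _-_ (trans (cong ℕtoℚ (+-comm 1 n)) (ℕtoℚ-+ n 1)) (inv-inverseˡ {suc n} (s≤s z≤n)) ⟩
  (ℕtoℚ n ℚ.+ 1ℚ) - 1ℚ
    ≡⟨ solve 1 (λ x → (x :+ con 1ℚ) :- con 1ℚ := x) refl (ℕtoℚ n) ⟩
  ℕtoℚ n ∎
  where open ≡-Reasoning; open +-*-Solver

∏[1-1/q]*∏q≡∏[q-1] : ∀ (q : ℕ → ℕ) xs →
  foldr ℚ._*_ 1ℚ (map (λ j → 1ℚ - inv (q j)) xs) ℚ.* ℕtoℚ (foldr _*_ 1 (map q xs)) ≡ ℕtoℚ (foldr _*_ 1 (map (pred ∘ q) xs))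
∏[1-1/q]*∏q≡∏[q-1] q []       = refl
∏[1-1/q]*∏q≡∏[q-1] q (x ∷ xs) = begin
  (F ℚ.* R) ℚ.* ℕtoℚ (q x * P)                   ≡⟨ cong ((F ℚ.* R) ℚ.*_) (ℕtoℚ-* (q x) P) ⟩
  (F ℚ.* R) ℚ.* (ℕtoℚ (q x) ℚ.* ℕtoℚ P)          ≡⟨ solve 4 (λ a b c d → (a :* b) :* (c :* d) := (a :* c) :* (b :* d)) refl F R (ℕtoℚ (q x)) (ℕtoℚ P) ⟩
  (F ℚ.* ℕtoℚ (q x)) ℚ.* (R ℚ.* ℕtoℚ P)          ≡⟨ cong₂ ℚ._*_ ([1-inv]*ℕtoℚ (q x)) (∏[1-1/q]*∏q≡∏[q-1] q xs) ⟩
  ℕtoℚ (pred (q x)) ℚ.* ℕtoℚ P′                   ≡⟨ sym (ℕtoℚ-* (pred (q x)) P′) ⟩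
  ℕtoℚ (pred (q x) * P′)                          ∎
  where
  open ≡-Reasoning
  open +-*-Solver
  F = 1ℚ - inv (q x)
  R = foldr ℚ._*_ 1ℚ (map (λ j → 1ℚ - inv (q j)) xs)
  P = foldr _*_ 1 (map q xs)
  P′ = foldr _*_ 1 (map (pred ∘ q) xs)

d≤1⇒2∏[q-1]≤∏q : ∀ q a b → d q a b ℚ.≤ 1ℚ → 2 * ∏ (pred ∘ q) a (suc b ∸ a) ≤ ∏ q a (suc b ∸ a)
d≤1⇒2∏[q-1]≤∏q q a b d≤1 = subst₂ _≤_ (cong (2 *_) (prodℕ≡∏ (pred ∘ q) a b)) (prodℕ≡∏ q a b) $ ℕtoℚ-cancel-≤ $ begin
  ℕtoℚ (2 * prodℕ (pred ∘ q) a b)  ≡⟨ sym d*∏q≡2∏[q-1] ⟩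
  d q a b ℚ.* ℕtoℚ P               ≤⟨ ℚ.*-monoʳ-≤-nonNeg (ℕtoℚ P) {{ℚ.nonNegative (ℕtoℚ-nonNeg P)}} d≤1 ⟩
  1ℚ ℚ.* ℕtoℚ P                    ≡⟨ ℚ.*-identityˡ (ℕtoℚ P) ⟩
  ℕtoℚ P                           ∎
  where
  open ℚ.≤-Reasoning
  P = prodℕ q a b
  d*∏q≡2∏[q-1] : d q a b ℚ.* ℕtoℚ P ≡ ℕtoℚ (2 * prodℕ (pred ∘ q) a b)
  d*∏q≡2∏[q-1] = trans (ℚ.*-assoc (ℕtoℚ 2) (prodℚ (λ j → 1ℚ - inv (q j)) a b) (ℕtoℚ P))
    (trans (cong (ℕtoℚ 2 ℚ.*_) (∏[1-1/q]*∏q≡∏[q-1] q (range a b))) (sym (ℕtoℚ-* 2 (prodℕ (pred ∘ q) a b))))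

-- For a = 2 + b this is (1 − 1/x)² ≥ (4a − 5)/(4a − 1) when x ≥ 2a − 1.
telescope-step : ∀ b x → 3 + 2 * b ≤ x → (3 + 4 * b) * (x * x) ≤ (3 + 4 * suc b) * (pred x * pred x)
telescope-step b x 3+2b≤x with m≤n⇒∃[o]m+o≡n 3+2b≤x
... | y , refl = begin
  (3 + 4 * b) * ((3 + 2 * b + y) * (3 + 2 * b + y))                                          ≤⟨ m≤m+n _ _ ⟩
  (3 + 4 * b) * ((3 + 2 * b + y) * (3 + 2 * b + y)) + (1 + 10 * y + 8 * b * y + 4 * y * y) ≡⟨ expand b y ⟩
  (3 + 4 * suc b) * ((2 + 2 * b + y) * (2 + 2 * b + y))                                      ∎
  where
  open ≤-Reasoning
  expand : ∀ b y → (3 + 4 * b) * ((3 + 2 * b + y) * (3 + 2 * b + y)) + (1 + 10 * y + 8 * b * y + 4 * y * y)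
                 ≡ (3 + 4 * suc b) * ((2 + 2 * b + y) * (2 + 2 * b + y))
  expand = solve-∀

-- ∏_{j=a}^{a+n−1} (4j − 5)/(4j − 1) = (4a − 5)/(4(a + n) − 5), with a = 2 + b.
∏-telescope : ∀ q b n → AllIn (2 + b) n (λ j → 2 * j ∸ 1 ≤ q j) →
              (3 + 4 * b) * (∏ q (2 + b) n * ∏ q (2 + b) n) ≤ (3 + 4 * (b + n)) * (∏ (pred ∘ q) (2 + b) n * ∏ (pred ∘ q) (2 + b) n)
∏-telescope q b zero    q≥ = ≤-reflexive (cong (λ c → (3 + 4 * c) * 1) (sym (+-identityʳ b)))
∏-telescope q b (suc n) q≥ = begin
  (3 + 4 * b) * ((x * P) * (x * P))                 ≡⟨ regroup (3 + 4 * b) x P ⟩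
  ((3 + 4 * b) * (x * x)) * (P * P)                 ≤⟨ *-monoˡ-≤ (P * P) (telescope-step b x (subst (_≤ x) (2[2+b]∸1 b) (AllIn-head _ q≥))) ⟩
  ((3 + 4 * suc b) * (x′ * x′)) * (P * P)           ≡⟨ regroup′ (3 + 4 * suc b) x′ P ⟩
  (x′ * x′) * ((3 + 4 * suc b) * (P * P))           ≤⟨ *-monoʳ-≤ (x′ * x′) (∏-telescope q (suc b) n (AllIn-tail _ q≥)) ⟩
  (x′ * x′) * ((3 + 4 * (suc b + n)) * (P′ * P′))   ≡⟨ cong (λ c → (x′ * x′) * ((3 + 4 * c) * (P′ * P′))) (sym (+-suc b n)) ⟩
  (x′ * x′) * ((3 + 4 * (b + suc n)) * (P′ * P′))   ≡⟨ regroup″ (3 + 4 * (b + suc n)) x′ P′ ⟩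
  (3 + 4 * (b + suc n)) * ((x′ * P′) * (x′ * P′))   ∎
  where
  open ≤-Reasoning
  x  = q (2 + b)
  x′ = pred x
  P  = ∏ q (3 + b) n
  P′ = ∏ (pred ∘ q) (3 + b) n
  2[2+b]∸1 : ∀ b → 2 * (2 + b) ∸ 1 ≡ 3 + 2 * b
  2[2+b]∸1 b = cong (_∸ 1) (*-distribˡ-+ 2 2 b)
  regroup : ∀ c x P → c * ((x * P) * (x * P)) ≡ (c * (x * x)) * (P * P)
  regroup = solve-∀
  regroup′ : ∀ c y P → (c * (y * y)) * (P * P) ≡ (y * y) * (c * (P * P))
  regroup′ = solve-∀
  regroup″ : ∀ c y P → (y * y) * (c * (P * P)) ≡ c * ((y * P) * (y * P))
  regroup″ = solve-∀

∏[1-1/q]≤½-telescoped : ∀ q b n → AllIn (2 + b) n (λ j → 2 * j ∸ 1 ≤ q j) →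
                        2 * ∏ (pred ∘ q) (2 + b) n ≤ ∏ q (2 + b) n → 4 * (3 + 4 * b) ≤ 3 + 4 * (b + n)
∏[1-1/q]≤½-telescoped q b n q≥ half = *-cancelʳ-≤ _ _ (P′ * P′) {{>-nonZero (*-mono-≤ P′≥1 P′≥1)}} $ begin
  4 * (3 + 4 * b) * (P′ * P′)          ≡⟨ regroup (3 + 4 * b) P′ ⟩
  (3 + 4 * b) * ((2 * P′) * (2 * P′))  ≤⟨ *-monoʳ-≤ (3 + 4 * b) (*-mono-≤ half half) ⟩
  (3 + 4 * b) * (P * P)                ≤⟨ ∏-telescope q b n q≥ ⟩
  (3 + 4 * (b + n)) * (P′ * P′)        ∎
  where
  open ≤-Reasoning
  P  = ∏ q (2 + b) n
  P′ = ∏ (pred ∘ q) (2 + b) n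
  P′≥1 : 1 ≤ P′
  P′≥1 = ∏-positive (pred ∘ q) (2 + b) n λ {j} a≤j j<a+n →
    pred-mono-≤ (≤-trans (≤-trans (n≤1+n 2) (∸-monoˡ-≤ 1 (*-monoʳ-≤ 2 (≤-trans (s≤s (s≤s z≤n)) a≤j)))) (q≥ a≤j j<a+n))
  regroup : ∀ c P′ → 4 * c * (P′ * P′) ≡ c * ((2 * P′) * (2 * P′))
  regroup = solve-∀

weights-arith : ∀ b n → n ≤ b + 6 → 4 * (3 + 4 * b) ≤ 3 + 4 * (b + n) → b ≤ 1
weights-arith b n n≤b+6 weights = ≤-pred (*-cancelˡ-< 8 b 2 $ +-cancelʳ-≤ (12 + 8 * b) _ _ $ begin
  suc (8 * b) + (12 + 8 * b)   ≡⟨ e₁ b ⟩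
  1 + 4 * (3 + 4 * b)          ≤⟨ s≤s weights ⟩
  1 + (3 + 4 * (b + n))        ≤⟨ +-monoʳ-≤ 4 (*-monoʳ-≤ 4 (+-monoʳ-≤ b n≤b+6)) ⟩
  1 + (3 + 4 * (b + (b + 6)))  ≡⟨ e₂ b ⟩
  8 * 2 + (12 + 8 * b)         ∎)
  where
  open ≤-Reasoning
  e₁ : ∀ b → suc (8 * b) + (12 + 8 * b) ≡ 1 + 4 * (3 + 4 * b)
  e₁ = solve-∀
  e₂ : ∀ b → 1 + (3 + 4 * (b + (b + 6))) ≡ 8 * 2 + (12 + 8 * b)
  e₂ = solve-∀

-- Euler's totient

𝟙 : {A : Set} → Dec A → ℕ
𝟙 (yes _) = 1
𝟙 (no  _) = 0

𝟙-cong : ∀ {A B : Set} (a? : Dec A) (b? : Dec B) → A ⇔ B → 𝟙 a? ≡ 𝟙 b?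
𝟙-cong (yes _) (yes _) A⇔B = refl
𝟙-cong (yes a) (no ¬b) A⇔B = contradiction (Equivalence.to A⇔B a) ¬b
𝟙-cong (no ¬a) (yes b) A⇔B = contradiction (Equivalence.from A⇔B b) ¬a
𝟙-cong (no _)  (no _)  A⇔B = refl

count : {P : Pred ℕ _} → Decidable P → ℕ → ℕ
count P? zero    = 0
count P? (suc n) = count P? n + 𝟙 (P? (suc n))

count-cong : ∀ {P Q : Pred ℕ _} (P? : Decidable P) (Q? : Decidable Q) → (∀ a → P a ⇔ Q a) →
             ∀ n → count P? n ≡ count Q? n
count-cong P? Q? P⇔Q zero    = refl
count-cong P? Q? P⇔Q (suc n) = cong₂ _+_ (count-cong P? Q? P⇔Q n) (𝟙-cong (P? (suc n)) (Q? (suc n)) (P⇔Q (suc n)))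

count-none : ∀ {P : Pred ℕ _} (P? : Decidable P) n → (∀ a → 1 ≤ a → a ≤ n → ¬ P a) → count P? n ≡ 0
count-none P? zero    none = refl
count-none P? (suc n) none with P? (suc n)
... | yes p = contradiction p (none (suc n) (s≤s z≤n) ≤-refl)
... | no  _ = trans (+-identityʳ _) (count-none P? n (λ a a≥1 a≤n → none a a≥1 (m≤n⇒m≤1+n a≤n)))

count-split : ∀ {P Q : Pred ℕ _} (P? : Decidable P) (Q? : Decidable Q) n →
              count P? n ≡ count (P? ∩? Q?) n + count (P? ∩? ∁? Q?) n
count-split P? Q? zero    = refl
count-split P? Q? (suc n) = begin
  count P? n + 𝟙 (P? (suc n))
    ≡⟨ cong₂ _+_ (count-split P? Q? n) (𝟙-split (P? (suc n)) (Q? (suc n))) ⟩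
  (count (P? ∩? Q?) n + count (P? ∩? ∁? Q?) n) + (𝟙 ((P? ∩? Q?) (suc n)) + 𝟙 ((P? ∩? ∁? Q?) (suc n)))
    ≡⟨ interchange (count (P? ∩? Q?) n) (count (P? ∩? ∁? Q?) n) (𝟙 ((P? ∩? Q?) (suc n))) (𝟙 ((P? ∩? ∁? Q?) (suc n))) ⟩
  count (P? ∩? Q?) (suc n) + count (P? ∩? ∁? Q?) (suc n) ∎
  where
  open ≡-Reasoning
  𝟙-split : ∀ {A B : Set} (a? : Dec A) (b? : Dec B) → 𝟙 a? ≡ 𝟙 (a? ×-dec b?) + 𝟙 (a? ×-dec ¬? b?)
  𝟙-split (yes _) (yes _) = refl
  𝟙-split (yes _) (no _)  = refl
  𝟙-split (no _)  _       = refl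
  interchange : ∀ a b c d → (a + b) + (c + d) ≡ (a + c) + (b + d)
  interchange = solve-∀

count-+ : ∀ {P : Pred ℕ _} (P? : Decidable P) n u → count P? (n + u) ≡ count P? n + count (P? ∘ (n +_)) u
count-+ P? n zero    = trans (cong (count P?) (+-identityʳ n)) (sym (+-identityʳ _))
count-+ {P} P? n (suc u) = begin
  count P? (n + suc u)                                         ≡⟨ cong (count P?) (+-suc n u) ⟩
  count P? (n + u) + 𝟙 (P? (suc (n + u)))                      ≡⟨ cong₂ _+_ (count-+ P? n u) (𝟙-cong (P? (suc (n + u))) (P? (n + suc u)) shift) ⟩
  count P? n + count (P? ∘ (n +_)) u + 𝟙 (P? (n + suc u))      ≡⟨ +-assoc (count P? n) _ _ ⟩
  count P? n + count (P? ∘ (n +_)) (suc u)                     ∎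
  where
  open ≡-Reasoning
  shift : P (suc (n + u)) ⇔ P (n + suc u)
  shift = mk⇔ (subst P (sym (+-suc n u))) (subst P (+-suc n u))

count-periodic : ∀ {P : Pred ℕ _} (P? : Decidable P) u → (∀ a → P (u + a) ⇔ P a) →
                 ∀ r → count P? (r * u) ≡ r * count P? u
count-periodic P? u periodic zero    = refl
count-periodic P? u periodic (suc r) =
  trans (count-+ P? u (r * u)) (cong (count P? u +_)
    (trans (count-cong (P? ∘ (u +_)) P? periodic (r * u)) (count-periodic P? u periodic r)))

count-multiples : ∀ {P : Pred ℕ _} (P? : Decidable P) r → .{{NonZero r}} →
                  ∀ n → count (P? ∩? (r ∣?_)) (r * n) ≡ count (P? ∘ (r *_)) n
count-multiples P? r zero    = cong (count (P? ∩? (r ∣?_))) (*-zeroʳ r)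
count-multiples {P} P? r@(suc r-1) (suc n) = begin
  count F (r * suc n)                            ≡⟨ cong (count F) (trans (*-suc r n) (+-comm r (r * n))) ⟩
  count F (r * n + r)                            ≡⟨ count-+ F (r * n) r ⟩
  count F (r * n) + count (F ∘ (r * n +_)) r      ≡⟨ cong₂ _+_ (count-multiples P? r n) last-block ⟩
  count (P? ∘ (r *_)) n + 𝟙 (P? (r * suc n))      ∎
  where
  open ≡-Reasoning
  F = P? ∩? (r ∣?_)
  r*n+r≡r*[1+n] : r * n + r ≡ r * suc n
  r*n+r≡r*[1+n] = trans (+-comm (r * n) r) (sym (*-suc r n))
  -- among r * n + 1, …, r * n + r only the last is a multiple of r
  last-block : count (F ∘ (r * n +_)) r ≡ 𝟙 (P? (r * suc n))
  last-block = cong₂ _+_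
    (count-none (F ∘ (r * n +_)) r-1 λ a a≥1 a≤r-1 (_ , r∣) →
       <⇒≱ (s≤s a≤r-1) (∣⇒≤ {{>-nonZero a≥1}} (∣m+n∣m⇒∣n r∣ (m∣m*n n))))
    (𝟙-cong (F (r * n + r)) (P? (r * suc n))
       (mk⇔ (subst P r*n+r≡r*[1+n] ∘ proj₁) (λ p → subst P (sym r*n+r≡r*[1+n]) p , ∣m∣n⇒∣m+n (m∣m*n n) ∣-refl)))

φ≡count : ∀ n → φ n ≡ count (λ a → Coprime.coprime? a n) n
φ≡count n = begin
  length (filter (gcd=1? n) (map suc (upTo n)))    ≡⟨ cong (length ∘ filter (gcd=1? n)) (map-upTo suc n) ⟩
  length (filter (gcd=1? n) (applyUpTo suc n))     ≡⟨ length-filter≡count (gcd=1? n) n ⟩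
  count (gcd=1? n) n                               ≡⟨ count-cong (gcd=1? n) (λ a → Coprime.coprime? a n) gcd≡1⇔coprime n ⟩
  count (λ a → Coprime.coprime? a n) n             ∎
  where
  open ≡-Reasoning
  gcd=1? : ∀ n a → Dec (gcd a n ≡ 1)
  gcd=1? n a = gcd a n ≟ 1
  gcd≡1⇔coprime : ∀ a → gcd a n ≡ 1 ⇔ Coprime a n
  gcd≡1⇔coprime a = mk⇔ Coprime.gcd≡1⇒coprime Coprime.coprime⇒gcd≡1
  length-filter≡count : ∀ {P : Pred ℕ _} (P? : Decidable P) n → length (filter P? (applyUpTo suc n)) ≡ count P? n
  length-filter≡count P? zero    = refl
  length-filter≡count P? (suc n) = begin
    length (filter P? (applyUpTo suc (suc n)))                        ≡⟨ cong (length ∘ filter P?) (sym (applyUpTo-∷ʳ suc n)) ⟩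
    length (filter P? (applyUpTo suc n ++ [ suc n ]))                 ≡⟨ cong length (filter-++ P? (applyUpTo suc n) [ suc n ]) ⟩
    length (filter P? (applyUpTo suc n) ++ filter P? [ suc n ])       ≡⟨ length-++ (filter P? (applyUpTo suc n)) ⟩
    length (filter P? (applyUpTo suc n)) + length (filter P? [ suc n ]) ≡⟨ cong₂ _+_ (length-filter≡count P? n) (length-filter-[x] (suc n)) ⟩
    count P? n + 𝟙 (P? (suc n))                                       ∎
    where
    length-filter-[x] : ∀ x → length (filter P? [ x ]) ≡ 𝟙 (P? x)
    length-filter-[x] x with P? x
    ... | yes _ = refl
    ... | no  _ = refl

prime∤⇒coprime : ∀ {r a} → Prime r → ¬ r ∣ a → Coprime r a
prime∤⇒coprime r-prime r∤a (d∣r , d∣a) with prime⇒irreducible r-prime d∣r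
... | inj₁ d≡1  = d≡1
... | inj₂ refl = contradiction d∣a r∤a

coprime-*-prime⇔ : ∀ {r u} a → Prime r → Coprime a (r * u) ⇔ (Coprime a u × ¬ r ∣ a)
coprime-*-prime⇔ {r} {u} a r-prime = mk⇔ to from
  where
  to : Coprime a (r * u) → Coprime a u × ¬ r ∣ a
  to a⊥ru = (λ (d∣a , d∣u) → a⊥ru (d∣a , ∣-trans d∣u (n∣m*n r))) ,
            (λ r∣a → nonTrivial⇒≢1 {{prime⇒nonTrivial r-prime}} (a⊥ru (r∣a , m∣m*n u)))
  from : Coprime a u × ¬ r ∣ a → Coprime a (r * u)
  from (a⊥u , r∤a) = coprime-* (Coprime.sym (prime∤⇒coprime r-prime r∤a)) a⊥u

coprime-*ˡ⇔ : ∀ {r u} b → Coprime r u → Coprime (r * b) u ⇔ Coprime b u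
coprime-*ˡ⇔ {r} {u} b r⊥u = mk⇔ to from
  where
  to : Coprime (r * b) u → Coprime b u
  to rb⊥u (d∣b , d∣u) = rb⊥u (∣-trans d∣b (n∣m*n r) , d∣u)
  from : Coprime b u → Coprime (r * b) u
  from b⊥u = Coprime.sym (coprime-* (Coprime.sym r⊥u) (Coprime.sym b⊥u))

coprime-+ˡ⇔ : ∀ u a → Coprime (u + a) u ⇔ Coprime a u
coprime-+ˡ⇔ u a = mk⇔ to Coprime.coprime-+
  where
  to : Coprime (u + a) u → Coprime a u
  to u+a⊥u (d∣a , d∣u) = u+a⊥u (∣m∣n⇒∣m+n d∣u d∣a , d∣u)

-- Of the numbers up to r u coprime to u (r copies of a reduced residue system mod u),
-- exactly φ u are multiples of r.
φ-prime-* : ∀ r u → Prime r → Coprime r u → φ (r * u) + φ u ≡ r * φ u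
φ-prime-* r u r-prime r⊥u = begin
  φ (r * u) + φ u                                    ≡⟨ cong₂ _+_ φ[ru]≡ φu≡ ⟩
  count (⊥u? ∩? ∁? r∣?) (r * u) + count (⊥u? ∩? r∣?) (r * u) ≡⟨ +-comm (count (⊥u? ∩? ∁? r∣?) (r * u)) (count (⊥u? ∩? r∣?) (r * u)) ⟩
  count (⊥u? ∩? r∣?) (r * u) + count (⊥u? ∩? ∁? r∣?) (r * u) ≡⟨ sym (count-split ⊥u? r∣? (r * u)) ⟩
  count ⊥u? (r * u)                                  ≡⟨ count-periodic ⊥u? u (coprime-+ˡ⇔ u) r ⟩
  r * count ⊥u? u                                    ≡⟨ cong (r *_) (sym (φ≡count u)) ⟩
  r * φ u                                            ∎
  where
  open ≡-Reasoning
  instance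
    r≢0 : NonZero r
    r≢0 = prime⇒nonZero r-prime
  ⊥u? : Decidable (λ a → Coprime a u)
  ⊥u? a = Coprime.coprime? a u
  r∣? : Decidable (r ∣_)
  r∣? = r ∣?_
  φ[ru]≡ : φ (r * u) ≡ count (⊥u? ∩? ∁? r∣?) (r * u)
  φ[ru]≡ = trans (φ≡count (r * u)) (count-cong (λ a → Coprime.coprime? a (r * u)) (⊥u? ∩? ∁? r∣?) (λ a → coprime-*-prime⇔ a r-prime) (r * u))
  φu≡ : φ u ≡ count (⊥u? ∩? r∣?) (r * u)
  φu≡ = sym (begin
    count (⊥u? ∩? r∣?) (r * u)  ≡⟨ count-multiples ⊥u? r u ⟩
    count (⊥u? ∘ (r *_)) u      ≡⟨ count-cong (⊥u? ∘ (r *_)) ⊥u? (λ b → coprime-*ˡ⇔ b r⊥u) u ⟩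
    count ⊥u? u                 ≡⟨ sym (φ≡count u) ⟩
    φ u                         ∎)

IncreasingOn : ℕ → ℕ → (ℕ → ℕ) → Set
IncreasingOn a n f = ∀ {j j′} → a ≤ j → j < j′ → j′ < a + n → f j < f j′

IncreasingOn-tail : ∀ {a n} f → IncreasingOn a (suc n) f → IncreasingOn (suc a) n f
IncreasingOn-tail {a} {n} f incr {j′ = j′} a<j j<j′ j′<a+n = incr (<⇒≤ a<j) j<j′ (subst (j′ <_) (sym (+-suc a n)) j′<a+n)

φ-∏ : ∀ f a n → AllIn a n (Prime ∘ f) → IncreasingOn a n f → φ (∏ f a n) ≡ ∏ (pred ∘ f) a n
φ-∏ f a zero    prime incr = refl
φ-∏ f a (suc n) prime incr = begin
  φ (f a * P)          ≡⟨ +-cancelʳ-≡ (φ P) _ _ (trans (φ-prime-* (f a) P fa-prime fa⊥P) fa*φP) ⟩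
  pred (f a) * φ P     ≡⟨ cong (pred (f a) *_) (φ-∏ f (suc a) n (AllIn-tail _ prime) (IncreasingOn-tail f incr)) ⟩
  pred (f a) * ∏ (pred ∘ f) (suc a) n ∎
  where
  open ≡-Reasoning
  P = ∏ f (suc a) n
  fa-prime : Prime (f a)
  fa-prime = AllIn-head (Prime ∘ f) prime
  instance
    fa≢0 : NonZero (f a)
    fa≢0 = prime⇒nonZero fa-prime
  fa⊥P : Coprime (f a) P
  fa⊥P = ∏-coprime (f a) f (suc a) n λ {j} a<j j<a+n →
    Coprime.sym (Coprime.prime⇒coprime (AllIn-tail _ prime a<j j<a+n) (incr ≤-refl a<j (subst (j <_) (sym (+-suc a n)) j<a+n)))
  fa*φP : f a * φ P ≡ pred (f a) * φ P + φ P
  fa*φP = trans (cong (_* φ P) (sym (suc-pred (f a)))) (+-comm (φ P) _)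

prime∣^⇒∣ : ∀ {r x} n → Prime r → r ∣ x ^ n → r ∣ x
prime∣^⇒∣ zero    r-prime r∣1 = contradiction (∣1⇒≡1 r∣1) (nonTrivial⇒≢1 {{prime⇒nonTrivial r-prime}})
prime∣^⇒∣ {x = x} (suc n) r-prime r∣x^[1+n] with euclidsLemma x (x ^ n) r-prime r∣x^[1+n]
... | inj₁ r∣x   = r∣x
... | inj₂ r∣x^n = prime∣^⇒∣ n r-prime r∣x^n

∣⇒∣^ : ∀ {r x} n → 1 ≤ n → r ∣ x → r ∣ x ^ n
∣⇒∣^ {x = x} (suc n) _ r∣x = ∣m⇒∣m*n (x ^ n) r∣x

-- Increasing sequences of primes

2∣n⊎2∣1+n : ∀ n → 2 ∣ n ⊎ 2 ∣ suc n
2∣n⊎2∣1+n zero    = inj₁ (divides 0 refl)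
2∣n⊎2∣1+n (suc n) with 2∣n⊎2∣1+n n
... | inj₁ (divides k eq) = inj₂ (divides (suc k) (cong (suc ∘ suc) eq))
... | inj₂ 2∣1+n          = inj₁ 2∣1+n

odd-gap : ∀ {x y} → ¬ 2 ∣ x → ¬ 2 ∣ y → x < y → 2 + x ≤ y
odd-gap {x} x-odd y-odd x<y with m≤n⇒m<n∨m≡n x<y
... | inj₁ 1+x<y = 1+x<y
... | inj₂ refl  = ⊥-elim ([ x-odd , y-odd ]′ (2∣n⊎2∣1+n x))

-- Lower bounds for q j, 2 ≤ j ≤ m, in an increasing sequence of primes 2 = q 1 < ⋯ < q m with
-- q m ≥ 131: consecutive odd primes differ by at least 2, and 9 is not prime.
oddPrimeBound : ℕ → ℕ
oddPrimeBound j = if j <ᵇ 5 then 2 * j ∸ 1 else 2 * j + 1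

lowerBound : ℕ → ℕ → ℕ
lowerBound m j = if j <ᵇ m then oddPrimeBound j else 131

∏[1-1/lowerBound]>½ : ∀ m → m ≤ 9 → ¬ (2 * ∏ (pred ∘ lowerBound m) 3 (suc m ∸ 3) ≤ ∏ (lowerBound m) 3 (suc m ∸ 3))
∏[1-1/lowerBound]>½ 0 _ = ≤⇒≤ᵇ
∏[1-1/lowerBound]>½ 1 _ = ≤⇒≤ᵇ
∏[1-1/lowerBound]>½ 2 _ = ≤⇒≤ᵇ
∏[1-1/lowerBound]>½ 3 _ = ≤⇒≤ᵇ
∏[1-1/lowerBound]>½ 4 _ = ≤⇒≤ᵇ
∏[1-1/lowerBound]>½ 5 _ = ≤⇒≤ᵇ
∏[1-1/lowerBound]>½ 6 _ = ≤⇒≤ᵇ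
∏[1-1/lowerBound]>½ 7 _ = ≤⇒≤ᵇ
∏[1-1/lowerBound]>½ 8 _ = ≤⇒≤ᵇ
∏[1-1/lowerBound]>½ 9 _ = ≤⇒≤ᵇ
∏[1-1/lowerBound]>½ (suc (suc (suc (suc (suc (suc (suc (suc (suc (suc _)))))))))) m≤9 = ⊥-elim (≤⇒≤ᵇ m≤9)

record IncreasingPrimes (m : ℕ) (q : ℕ → ℕ) : Set where
  field
    q₁≡2       : q 1 ≡ 2
    prime      : ∀ j → 1 ≤ j → j ≤ m → Prime (q j)
    increasing : ∀ j → 1 ≤ j → j < m → q j < q (suc j)

module IncreasingPrimesProperties {m q} (Q : IncreasingPrimes m q) where
  open IncreasingPrimes Q

  q-mono : ∀ {j j′} → 1 ≤ j → j < j′ → j′ ≤ m → q j < q j′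
  q-mono {j} {suc j′} j≥1 (s≤s j≤j′) j′<m with m≤n⇒m<n∨m≡n j≤j′
  ... | inj₁ j<j′ = <-trans (q-mono j≥1 j<j′ (<⇒≤ j′<m)) (increasing j′ (≤-trans j≥1 j≤j′) j′<m)
  ... | inj₂ refl = increasing j j≥1 j′<m

  increasingOn : ∀ {a n} → 1 ≤ a → a + n ≤ suc m → IncreasingOn a n q
  increasingOn a≥1 a+n≤1+m a≤j j<j′ j′<a+n = q-mono (≤-trans a≥1 a≤j) j<j′ (≤-pred (≤-trans j′<a+n a+n≤1+m))

  primeOn : ∀ {a n} → 1 ≤ a → a + n ≤ suc m → AllIn a n (Prime ∘ q)
  primeOn a≥1 a+n≤1+m a≤j j<a+n = prime _ (≤-trans a≥1 a≤j) (≤-pred (≤-trans j<a+n a+n≤1+m))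

  q-odd : ∀ {j} → 2 ≤ j → j ≤ m → ¬ 2 ∣ q j
  q-odd {j} j≥2 j≤m 2∣qj with prime⇒irreducible (prime j (≤-trans (s≤s z≤n) j≥2) j≤m) 2∣qj
  ... | inj₁ ()
  ... | inj₂ 2≡qj = <-irrefl (trans q₁≡2 2≡qj) (q-mono ≤-refl j≥2 j≤m)

  q-gap : ∀ {j} → 2 ≤ j → j < m → 2 + q j ≤ q (suc j)
  q-gap j≥2 j<m = odd-gap (q-odd j≥2 (<⇒≤ j<m)) (q-odd (≤-trans j≥2 (n≤1+n _)) j<m) (increasing _ (≤-trans (s≤s z≤n) j≥2) j<m)

  q-gaps : ∀ j e → 2 ≤ j → j + e ≤ m → q j + 2 * e ≤ q (j + e)
  q-gaps j zero    j≥2 _      = ≤-reflexive (trans (+-identityʳ (q j)) (cong q (sym (+-identityʳ j))))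
  q-gaps j (suc e) j≥2 j+e<m′ = begin
    q j + 2 * suc e       ≡⟨ cong (q j +_) (*-suc 2 e) ⟩
    q j + (2 + 2 * e)     ≡⟨ +-comm (q j) (2 + 2 * e) ⟩
    2 + (2 * e + q j)     ≡⟨ cong (2 +_) (+-comm (2 * e) (q j)) ⟩
    2 + (q j + 2 * e)     ≤⟨ +-monoʳ-≤ 2 (q-gaps j e j≥2 (<⇒≤ j+e<m)) ⟩
    2 + q (j + e)         ≤⟨ q-gap (≤-trans j≥2 (m≤m+n j e)) j+e<m ⟩
    q (suc (j + e))       ≡⟨ cong q (sym (+-suc j e)) ⟩
    q (j + suc e)         ∎
    where
    open ≤-Reasoning
    j+e<m : j + e < m
    j+e<m = subst (_≤ m) (+-suc j e) j+e<m′

  2j∸1≤q : ∀ {j} → 2 ≤ j → j ≤ m → 2 * j ∸ 1 ≤ q j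
  2j∸1≤q {suc zero}    (s≤s ()) _
  2j∸1≤q {suc (suc e)} _ j≤m = begin
    2 * (2 + e) ∸ 1   ≡⟨ cong (_∸ 1) (*-distribˡ-+ 2 2 e) ⟩
    3 + 2 * e         ≤⟨ +-monoˡ-≤ (2 * e) (subst (_< q 2) q₁≡2 (increasing 1 ≤-refl (≤-trans (s≤s (s≤s z≤n)) j≤m))) ⟩
    q 2 + 2 * e       ≤⟨ q-gaps 2 e ≤-refl j≤m ⟩
    q (2 + e)         ∎
    where open ≤-Reasoning

  11≤q₅ : 5 ≤ m → 11 ≤ q 5
  11≤q₅ 5≤m with m≤n⇒m<n∨m≡n (2j∸1≤q {5} (s≤s (s≤s z≤n)) 5≤m)
  ... | inj₂ 9≡q₅ = contradiction (subst Prime (sym 9≡q₅) (prime 5 (s≤s z≤n) 5≤m)) (from-no (prime? 9))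
  ... | inj₁ 10≤q₅ with m≤n⇒m<n∨m≡n 10≤q₅
  ...   | inj₁ 11≤q₅  = 11≤q₅
  ...   | inj₂ 10≡q₅  = contradiction (subst (2 ∣_) 10≡q₅ (divides 5 refl)) (q-odd (s≤s (s≤s z≤n)) 5≤m)

  2j+1≤q : ∀ {j} → 5 ≤ j → j ≤ m → 2 * j + 1 ≤ q j
  2j+1≤q {j} 5≤j j≤m with m≤n⇒∃[o]m+o≡n 5≤j
  ... | e , refl = begin
    2 * (5 + e) + 1   ≡⟨ 2[5+e]+1≡11+2e e ⟩
    11 + 2 * e        ≤⟨ +-monoˡ-≤ (2 * e) (11≤q₅ (≤-trans 5≤j j≤m)) ⟩
    q 5 + 2 * e       ≤⟨ q-gaps 5 e (s≤s (s≤s z≤n)) j≤m ⟩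
    q (5 + e)         ∎
    where
    open ≤-Reasoning
    2[5+e]+1≡11+2e : ∀ e → 2 * (5 + e) + 1 ≡ 11 + 2 * e
    2[5+e]+1≡11+2e = solve-∀

  oddPrimeBound≤q : ∀ {j} → 2 ≤ j → j ≤ m → oddPrimeBound j ≤ q j
  oddPrimeBound≤q {j} j≥2 j≤m with j <ᵇ 5 in j<ᵇ5
  ... | true  = 2j∸1≤q j≥2 j≤m
  ... | false = 2j+1≤q (≮⇒≥ (λ j<5 → subst T j<ᵇ5 (<⇒<ᵇ j<5))) j≤m

  lowerBound≤q : 131 ≤ q m → ∀ {j} → 2 ≤ j → j ≤ m → lowerBound m j ≤ q j
  lowerBound≤q 131≤qm {j} j≥2 j≤m with j <ᵇ m in j<ᵇm
  ... | true  = oddPrimeBound≤q j≥2 j≤m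
  ... | false = subst (λ i → 131 ≤ q i) (≤-antisym (≮⇒≥ (λ j<m → subst T j<ᵇm (<⇒<ᵇ j<m))) j≤m) 131≤qm

  q≥2 : ∀ {j} → 1 ≤ j → j ≤ m → 2 ≤ q j
  q≥2 j≥1 j≤m = nonTrivial⇒n>1 _ {{prime⇒nonTrivial (prime _ j≥1 j≤m)}}

  ∏[1-1/q]≤½⇒start≤3 : ∀ a → 2 ≤ a → m ≤ 2 * a + 3 → 2 * ∏ (pred ∘ q) a (suc m ∸ a) ≤ ∏ q a (suc m ∸ a) → a ≤ 3
  ∏[1-1/q]≤½⇒start≤3 a a≥2 m≤2a+3 half with a ≤? m
  ... | no  a≰m = contradiction (subst (λ n → 2 * ∏ (pred ∘ q) a n ≤ ∏ q a n) (m≤n⇒m∸n≡0 (≰⇒> a≰m)) half) λ { (s≤s ()) }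
  ∏[1-1/q]≤½⇒start≤3 (suc zero)    (s≤s ()) _ _ | yes _
  ∏[1-1/q]≤½⇒start≤3 (suc (suc b)) _ m≤2a+3 half | yes a≤m =
    s≤s (s≤s (weights-arith b n n≤b+6 (∏[1-1/q]≤½-telescoped q b n q≥2j∸1 half)))
    where
    n = suc m ∸ suc (suc b)
    2+b+n≡1+m : 2 + b + n ≡ suc m
    2+b+n≡1+m = m+[n∸m]≡n (≤-trans a≤m (n≤1+n m))
    q≥2j∸1 : AllIn (2 + b) n (λ j → 2 * j ∸ 1 ≤ q j)
    q≥2j∸1 {j} a≤j j<a+n = 2j∸1≤q (≤-trans (s≤s (s≤s z≤n)) a≤j) (≤-pred (subst (j <_) 2+b+n≡1+m j<a+n))
    n≤b+6 : n ≤ b + 6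
    n≤b+6 = +-cancelˡ-≤ (2 + b) _ _ $ begin
      2 + b + n              ≡⟨ 2+b+n≡1+m ⟩
      suc m                  ≤⟨ s≤s m≤2a+3 ⟩
      suc (2 * (2 + b) + 3)  ≡⟨ regroup b ⟩
      2 + b + (b + 6)        ∎
      where
      open ≤-Reasoning
      regroup : ∀ b → suc (2 * (2 + b) + 3) ≡ 2 + b + (b + 6)
      regroup = solve-∀

  ¬∏[1-1/q]≤½-from-3 : 131 ≤ q m → m ≤ 9 → ¬ (2 * ∏ (pred ∘ q) 3 (suc m ∸ 3) ≤ ∏ q 3 (suc m ∸ 3))
  ¬∏[1-1/q]≤½-from-3 131≤qm m≤9 half = ∏[1-1/lowerBound]>½ m m≤9 $
    ∏[1-1/x]≤½-mono (lowerBound m) q 3 n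
      (λ 3≤j j<3+n → lowerBound≤q 131≤qm (≤-trans (s≤s (s≤s z≤n)) 3≤j) (interval-bound 3≤j j<3+n))
      (∏-positive q 3 n λ 3≤j j<3+n → ≤-trans (s≤s z≤n) (q≥2 (≤-trans (s≤s z≤n) 3≤j) (interval-bound 3≤j j<3+n)))
      half
    where
    n = suc m ∸ 3

  k≤3 : ∀ k → IsK q m k → m ≤ 2 * k + 1 → 131 ≤ q m → k ≤ 3
  k≤3 zero    (() , _)
  k≤3 (suc a) (_ , d≤1 , _) m≤2k+1 131≤qm with suc a ≤? 3
  ... | yes k≤3 = k≤3
  ... | no  k≰3 = contradiction (subst (λ a → 2 * ∏ (pred ∘ q) a (suc m ∸ a) ≤ ∏ q a (suc m ∸ a)) a≡3 half)
                                (¬∏[1-1/q]≤½-from-3 131≤qm (subst (λ a → m ≤ 2 * a + 3) a≡3 m≤2a+3))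
    where
    half : 2 * ∏ (pred ∘ q) a (suc m ∸ a) ≤ ∏ q a (suc m ∸ a)
    half = d≤1⇒2∏[q-1]≤∏q q a m d≤1
    m≤2a+3 : m ≤ 2 * a + 3
    m≤2a+3 = subst (m ≤_) (2[1+a]+1≡2a+3 a) m≤2k+1
      where
      2[1+a]+1≡2a+3 : ∀ a → 2 * suc a + 1 ≡ 2 * a + 3
      2[1+a]+1≡2a+3 = solve-∀
    a≡3 : a ≡ 3
    a≡3 = ≤-antisym (∏[1-1/q]≤½⇒start≤3 a (≤-trans (n≤1+n 2) (≤-pred (≰⇒> k≰3))) m≤2a+3 half) (≤-pred (≰⇒> k≰3))

-- Choice of s and t

Suitable : ℕ → ℕ → ℕ → Set
Suitable p s t = 1 ≤ s × 1 ≤ t × Coprime s t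
  × (∀ r → Prime r → (r ∣ p ∸ 1) ⇔ (r ∣ s * t))
  × GtSqrt (ℕtoℚ (2 * φ t) ℚ.* inv t - 1ℚ - ℕtoℚ (4 * s + 2) ℚ.* inv (p ∸ 1))
           (ℕtoℚ (4 * s ∸ 2) ℚ.* inv (p ∸ 1)) p

-- For t = q c ⋯ q (c + n − 1): with B = ∏ b j and B′ = ∏ (b j − 1) over the lower bounds
-- b = lowerBound m, so that φ t / t ≥ B′/B and G/B = 2B′/B − 1, these are the numerical
-- hypotheses of criterion-from-bounds; R is any number with s R ≤ 2 t.
enoughMargin : ℕ → ℕ → ℕ → ℕ → Bool
enoughMargin m c n R = (60 ≤ᵇ G) ∧ (3200 * (B * B) <ᵇ 81 * (G * G) * R)
  where
  B = ∏ (lowerBound m) c n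
  G = 2 * ∏ (pred ∘ lowerBound m) c n ∸ B

module Witness {N m : ℕ} {q e : ℕ → ℕ} (Q : IncreasingPrimes m q) (e≥1 : ∀ j → 1 ≤ j → j ≤ m → 1 ≤ e j)
               (N≡ : N ≡ prodℕ (λ j → q j ^ e j) 1 m) (131≤qm : 131 ≤ q m) where
  open IncreasingPrimes Q
  open IncreasingPrimesProperties Q

  N≡∏ : N ≡ ∏ (λ j → q j ^ e j) 1 m
  N≡∏ = trans N≡ (prodℕ≡∏ (λ j → q j ^ e j) 1 m)

  ∏q≤N : ∏ q 1 m ≤ N
  ∏q≤N = subst (∏ q 1 m ≤_) (sym N≡∏) $ ∏-mono-≤ q (λ j → q j ^ e j) 1 m λ {j} 1≤j j<1+m →
    let instance _ = prime⇒nonZero (prime j 1≤j (≤-pred j<1+m))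
    in subst (_≤ q j ^ e j) (^-identityʳ (q j)) (^-monoʳ-≤ (q j) (e≥1 j 1≤j (≤-pred j<1+m)))

  N-prime-divisors : ∀ r → Prime r → (r ∣ N) ⇔ (r ∣ ∏ q 1 m)
  N-prime-divisors r r-prime = mk⇔
    (λ r∣N → ∏-prime-∣ (λ j → q j ^ e j) q 1 m r-prime (λ {j} _ _ → prime∣^⇒∣ (e j) r-prime) (subst (r ∣_) N≡∏ r∣N))
    (λ r∣∏ → subst (r ∣_) (sym N≡∏) (∏-prime-∣ q (λ j → q j ^ e j) 1 m r-prime
               (λ {j} 1≤j j<1+m → ∣⇒∣^ (e j) (e≥1 j 1≤j (≤-pred j<1+m))) r∣∏))

  module _ (nS nT : ℕ) (nS+nT≡m : nS + nT ≡ m) where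
    s = ∏ q 1 nS
    t = ∏ q (suc nS) nT

    inS : AllIn 1 nS (λ j → 1 ≤ j × j ≤ nS)
    inS 1≤j j<1+nS = 1≤j , ≤-pred j<1+nS

    inT : AllIn (suc nS) nT (λ j → suc nS ≤ j × j ≤ m)
    inT {j} 1+nS≤j j<1+nS+nT = 1+nS≤j , ≤-pred (subst (j <_) (cong suc nS+nT≡m) j<1+nS+nT)

    s*t≡∏ : s * t ≡ ∏ q 1 m
    s*t≡∏ = trans (sym (∏-+ q 1 nS nT)) (cong (∏ q 1) nS+nT≡m)

    s⊥t : Coprime s t
    s⊥t = Coprime.sym $ ∏-coprime t q 1 nS λ {j} 1≤j j<1+nS →
      Coprime.sym $ ∏-coprime (q j) q (suc nS) nT λ {j′} 1+nS≤j′ j′<1+nS+nT →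
      let (j≥1 , j≤nS) = inS 1≤j j<1+nS
          (j<j′ , j′≤m) = inT 1+nS≤j′ j′<1+nS+nT
          instance _ = prime⇒nonZero (prime j j≥1 (≤-trans j≤nS (≤-trans (m≤m+n nS nT) (≤-reflexive nS+nT≡m))))
      in Coprime.sym (Coprime.prime⇒coprime (prime j′ (≤-trans (s≤s z≤n) j<j′) j′≤m) (q-mono j≥1 (≤-trans (s≤s j≤nS) j<j′) j′≤m))

    inRange : suc nS + nT ≤ suc m
    inRange = ≤-reflexive (cong suc nS+nT≡m)

    s≥1 : 1 ≤ s
    s≥1 = ∏-positive q 1 nS λ 1≤j j<1+nS →
      ≤-trans (s≤s z≤n) (q≥2 1≤j (≤-trans (proj₂ (inS 1≤j j<1+nS)) (≤-trans (m≤m+n nS nT) (≤-reflexive nS+nT≡m))))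

    t≥1 : 1 ≤ t
    t≥1 = ∏-positive q (suc nS) nT λ 1+nS≤j j<1+nS+nT →
      ≤-trans (s≤s z≤n) (q≥2 (≤-trans (s≤s z≤n) 1+nS≤j) (proj₂ (inT 1+nS≤j j<1+nS+nT)))

    φt≡∏ : φ t ≡ ∏ (pred ∘ q) (suc nS) nT
    φt≡∏ = φ-∏ q (suc nS) nT (primeOn (s≤s z≤n) inRange) (increasingOn (s≤s z≤n) inRange)

    suitable : 1 ≤ nS → ∀ R → s * R ≤ 2 * t → T (enoughMargin m (suc nS) nT R) → Suitable (suc N) s t
    suitable nS≥1 R sR≤2t margin =
      let 60≤G , margin′ = Equivalence.to T-∧ margin
          B≥1 = ≤-trans (s≤s z≤n) (≤-trans (≤ᵇ⇒≤ 60 G 60≤G) G≤B)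
          t+E≡2φt , Gt≤EB = excess-lower-bound t (φ t) B B′ G B≥1 (G+B≡2B′ (≤ᵇ⇒≤ 60 G 60≤G)) B′t≤φtB
          slack , bound = criterion-from-bounds s t E B G R s≥1 B≥1 (∏-mono-≤ b q (suc nS) nT b≤q) Gt≤EB
                            (≤ᵇ⇒≤ 60 G 60≤G) sR≤2t (<ᵇ⇒< _ _ margin′)
      in s≥1 , t≥1 , s⊥t ,
         (λ r r-prime → subst (λ x → (r ∣ N) ⇔ (r ∣ x)) (sym s*t≡∏) (N-prime-divisors r r-prime)) ,
         gtSqrt-criterion s t N (φ t) E t+E≡2φt s≥1 t≥1 (subst (_≤ N) (sym s*t≡∏) ∏q≤N) slack bound
      where
      b = lowerBound m
      B = ∏ b (suc nS) nT
      B′ = ∏ (pred ∘ b) (suc nS) nT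
      G = 2 * B′ ∸ B
      E = 2 * φ t ∸ t
      b≤q : AllIn (suc nS) nT (λ j → b j ≤ q j)
      b≤q 1+nS≤j j<1+nS+nT = lowerBound≤q 131≤qm (≤-trans (s≤s nS≥1) 1+nS≤j) (proj₂ (inT 1+nS≤j j<1+nS+nT))
      G≤B : G ≤ B
      G≤B = subst (G ≤_) (trans (cong (λ x → B + x ∸ B) (+-identityʳ B)) (m+n∸m≡n B B))
                  (∸-monoˡ-≤ B (*-monoʳ-≤ 2 (∏-mono-≤ (pred ∘ b) b (suc nS) nT λ _ _ → pred[n]≤n)))
      G+B≡2B′ : 60 ≤ G → G + B ≡ 2 * B′
      G+B≡2B′ 60≤G = m∸n+n≡m {2 * B′} {B} (<⇒≤ (m∸n≢0⇒n<m λ G≡0 → contradiction (subst (60 ≤_) G≡0 60≤G) λ ()))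
      B′t≤φtB : B′ * t ≤ φ t * B
      B′t≤φtB = subst (λ x → B′ * t ≤ x * B) (sym φt≡∏) (∏[1-1/x]-mono b q (suc nS) nT b≤q)

  split-after-q₁ : ∀ nT → 1 + nT ≡ m → T (enoughMargin m 2 nT (∏ (lowerBound m) 2 nT)) → ∃[ s ] ∃[ t ] Suitable (suc N) s t
  split-after-q₁ nT 1+nT≡m margin = _ , _ , suitable 1 nT 1+nT≡m ≤-refl _ sR≤2t margin
    where
    sR≤2t : q 1 * 1 * ∏ (lowerBound m) 2 nT ≤ 2 * ∏ q 2 nT
    sR≤2t = subst (λ x → x * 1 * ∏ (lowerBound m) 2 nT ≤ 2 * ∏ q 2 nT) (sym q₁≡2)
      (*-monoʳ-≤ 2 (∏-mono-≤ (lowerBound m) q 2 nT λ {j} 2≤j j<2+nT →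
        lowerBound≤q 131≤qm 2≤j (≤-pred (subst (j <_) (cong suc 1+nT≡m) j<2+nT))))

  split-after-q₂ : ∀ nT → 3 + nT ≡ m → T (enoughMargin m 3 (suc nT) (∏ (lowerBound m) 4 nT)) → ∃[ s ] ∃[ t ] Suitable (suc N) s t
  split-after-q₂ nT 3+nT≡m margin = _ , _ , suitable 2 (suc nT) (trans (+-suc 2 nT) 3+nT≡m) (s≤s z≤n) _ sR≤2t margin
    where
    R = ∏ (lowerBound m) 4 nT
    sR≤2t : q 1 * (q 2 * 1) * R ≤ 2 * (q 3 * ∏ q 4 nT)
    sR≤2t = begin
      q 1 * (q 2 * 1) * R    ≡⟨ cong₂ (λ x y → x * y * R) q₁≡2 (*-identityʳ (q 2)) ⟩
      2 * q 2 * R            ≡⟨ *-assoc 2 (q 2) R ⟩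
      2 * (q 2 * R)          ≤⟨ *-monoʳ-≤ 2 (*-mono-≤ (<⇒≤ (increasing 2 (s≤s z≤n) (≤-trans (s≤s (s≤s (s≤s z≤n))) (≤-reflexive 3+nT≡m))))
                                (∏-mono-≤ (lowerBound m) q 4 nT λ {j} 4≤j j<4+nT →
                                  lowerBound≤q 131≤qm (≤-trans (s≤s (s≤s z≤n)) 4≤j) (≤-pred (subst (j <_) (cong suc 3+nT≡m) j<4+nT)))) ⟩
      2 * (q 3 * ∏ q 4 nT)   ∎
      where open ≤-Reasoning

suitable-exists : ∀ m {N : ℕ} {q e : ℕ → ℕ} → 2 ≤ m → m ≤ 7 → IncreasingPrimes m q → (∀ j → 1 ≤ j → j ≤ m → 1 ≤ e j) →
                  N ≡ prodℕ (λ j → q j ^ e j) 1 m → 131 ≤ q m → ∃[ s ] ∃[ t ] Suitable (suc N) s t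
suitable-exists 2 _ _ Q e≥1 N≡ 131≤qm = Witness.split-after-q₁ Q e≥1 N≡ 131≤qm 1 refl tt
suitable-exists 3 _ _ Q e≥1 N≡ 131≤qm = Witness.split-after-q₁ Q e≥1 N≡ 131≤qm 2 refl tt
suitable-exists 4 _ _ Q e≥1 N≡ 131≤qm = Witness.split-after-q₂ Q e≥1 N≡ 131≤qm 1 refl tt
suitable-exists 5 _ _ Q e≥1 N≡ 131≤qm = Witness.split-after-q₂ Q e≥1 N≡ 131≤qm 2 refl tt
suitable-exists 6 _ _ Q e≥1 N≡ 131≤qm = Witness.split-after-q₂ Q e≥1 N≡ 131≤qm 3 refl tt
suitable-exists 7 _ _ Q e≥1 N≡ 131≤qm = Witness.split-after-q₂ Q e≥1 N≡ 131≤qm 4 refl tt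
suitable-exists 0 m≥2 _ = contradiction m≥2 ≤⇒≤ᵇ
suitable-exists 1 m≥2 _ = contradiction m≥2 ≤⇒≤ᵇ
suitable-exists (suc (suc (suc (suc (suc (suc (suc (suc _)))))))) _ m≤7 = contradiction m≤7 ≤⇒≤ᵇ

lemma3p5 : (p m : ℕ) (q i : ℕ → ℕ) →
    Prime p → ¬ (2 ∣ p) →
    1 ≤ m →
    q 1 ≡ 2 →
    (∀ j → 1 ≤ j → j ≤ m → Prime (q j)) →
    (∀ j → 1 ≤ j → j < m → q j < q (suc j)) →
    (∀ j → 1 ≤ j → j ≤ m → 1 ≤ i j) →
    p ∸ 1 ≡ prodℕ (λ j → q j ^ i j) 1 m →
    (∃[ k ] (IsK q m k × m ≤ 2 * k + 1)) →
    131 ≤ q m →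
    ∃[ s ] ∃[ t ] (1 ≤ s × 1 ≤ t × Coprime s t
      × (∀ r → Prime r → (r ∣ p ∸ 1) ⇔ (r ∣ s * t))
      × GtSqrt (ℕtoℚ (2 * φ t) Data.Rational.* inv t - 1ℚ
                  - ℕtoℚ (4 * s + 2) Data.Rational.* inv (p ∸ 1))
               (ℕtoℚ (4 * s ∸ 2) Data.Rational.* inv (p ∸ 1))
               p)
lemma3p5 zero    _ _ _ p-prime = ⊥-elim (NonZero.nonZero (prime⇒nonZero p-prime))
lemma3p5 (suc N) m q i _ _ m≥1 q₁≡2 prime increasing i≥1 N≡ (k , isK , m≤2k+1) 131≤qm =
  suitable-exists m m≥2 m≤7 Q i≥1 N≡ 131≤qm
  where
  Q : IncreasingPrimes m q
  Q = record { q₁≡2 = q₁≡2 ; prime = prime ; increasing = increasing }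
  m≤7 : m ≤ 7
  m≤7 = ≤-trans m≤2k+1 (+-monoˡ-≤ 1 (*-monoʳ-≤ 2 (IncreasingPrimesProperties.k≤3 Q k isK m≤2k+1 131≤qm)))
  m≥2 : 2 ≤ m
  m≥2 with m≤n⇒m<n∨m≡n m≥1
  ... | inj₁ m>1 = m>1
  ... | inj₂ refl = contradiction (subst (131 ≤_) q₁≡2 131≤qm) ≤⇒≤ᵇ
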